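{- Let $G$ be an atomic (theta, triangle)-free graph and let $acb$ be a path of $G$. Then $acb$ is a good $P_3$ of $G$ if and only if all of the following hold: (1) some hole of $G$ contains the vertices $a$, $c$ and $b$; (2) there is no wheel $(H,c)$ in $G$ with $a,b\in V(H)$; (3) there is no wheel $(H,c')$ in $G$ with $a,c,b\in V(H)$ and $cc'\in E(G)$.
   Context: Graphs are finite and simple; $\mathcal L$-free means no induced subgraph isomorphic to a member of $\mathcal L$. A path means an induced path; an $ab$-path has ends $a,b$. A hole is a chordless cycle of length at least $4$; a triangle is $K_3$. A theta is a graph made of three paths between two nonadjacent vertices $a,b$, each of length at least $2$, pairwise sharing only $a,b$, with no other edges than those of the paths. A wheel $(H,c)$ in $G$ is an induced subgraph consisting of a hole $H$ and a vertex $c$ having at least three neighbours in $H$. A clique separator of $G$ is a (possibly empty) set of pairwise adjacent vertices whose removal leaves at least two connected components; $G$ is atomic if it has no clique separator. A path $acb$ of $G$ is a good $P_3$ if for every $ab$-path $P$ of $G\setminus c$, no internal vertex of $P$ is adjacent to $c$. -}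

module Defs where

open import Data.Nat using (ℕ; zero; suc; _≤_)
open import Data.Fin using (Fin; toℕ)
open import Data.Bool using (Bool; true; false)
open import Data.List using (List; []; _∷_; _++_; [_]; length; lookup)
open import Data.List.Membership.Propositional using (_∈_; _∉_)
open import Data.Product using (Σ; ∃; ∃-syntax; _×_; _,_)
open import Data.Sum using (_⊎_)
open import Data.Empty using (⊥)
open import Relation.Nullary using (¬_)
open import Relation.Binary.PropositionalEquality using (_≡_; _≢_)

record Graph (n : ℕ) : Set where
  field
    E      : Fin n → Fin n → Bool
    sym    : ∀ x y → E x y ≡ E y x
    irrefl : ∀ x → E x x ≡ false

module _ {n : ℕ} (G : Graph n) where
  open Graph G

  V : Set
  V = Fin n

  Adj : V → V → Set
  Adj x y = E x y ≡ true

  IsPath : List V → Set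
  IsPath vs =
    (∀ (i j : Fin (length vs)) → toℕ i ≢ toℕ j → lookup vs i ≢ lookup vs j) ×
    (∀ (i j : Fin (length vs)) → toℕ j ≡ suc (toℕ i) → Adj (lookup vs i) (lookup vs j)) ×
    (∀ (i j : Fin (length vs)) → Adj (lookup vs i) (lookup vs j) →
       (toℕ j ≡ suc (toℕ i)) ⊎ (toℕ i ≡ suc (toℕ j)))

  ABPath : V → List V → V → Set
  ABPath a int b = IsPath (a ∷ (int ++ [ b ]))

  CycNext : (m : ℕ) → ℕ → ℕ → Set
  CycNext m i j = (j ≡ suc i) ⊎ (i ≡ 0 × suc j ≡ m)

  IsHole : List V → Set
  IsHole vs =
    (4 ≤ length vs) ×
    (∀ (i j : Fin (length vs)) → toℕ i ≢ toℕ j → lookup vs i ≢ lookup vs j) ×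
    (∀ (i j : Fin (length vs)) → CycNext (length vs) (toℕ i) (toℕ j) →
       Adj (lookup vs i) (lookup vs j)) ×
    (∀ (i j : Fin (length vs)) → Adj (lookup vs i) (lookup vs j) →
       CycNext (length vs) (toℕ i) (toℕ j) ⊎ CycNext (length vs) (toℕ j) (toℕ i))

  countNbrs : V → List V → ℕ
  countNbrs c [] = 0
  countNbrs c (x ∷ xs) with E c x
  ... | true  = suc (countNbrs c xs)
  ... | false = countNbrs c xs

  IsWheel : List V → V → Set
  IsWheel H c = IsHole H × c ∉ H × 3 ≤ countNbrs c H

  TriangleFree : Set
  TriangleFree = ¬ (∃[ x ] ∃[ y ] ∃[ z ] (Adj x y × Adj y z × Adj x z))

  NonEmpty : List V → Set
  NonEmpty xs = ∃[ y ] ∃[ ys ] (xs ≡ y ∷ ys)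

  Disjoint : List V → List V → Set
  Disjoint xs ys = ∀ x → x ∈ xs → x ∉ ys

  NoEdges : List V → List V → Set
  NoEdges xs ys = ∀ x y → x ∈ xs → y ∈ ys → ¬ Adj x y

  -- G contains a theta as an induced subgraph: nonadjacent a, b and three
  -- induced ab-paths of length ≥ 2 with pairwise disjoint interiors and no
  -- edges between different interiors (so only the path edges are present).
  HasTheta : Set
  HasTheta = ∃[ a ] ∃[ b ] ∃[ P₁ ] ∃[ P₂ ] ∃[ P₃ ]
    (¬ Adj a b ×
     ABPath a P₁ b × ABPath a P₂ b × ABPath a P₃ b ×
     NonEmpty P₁ × NonEmpty P₂ × NonEmpty P₃ ×
     Disjoint P₁ P₂ × Disjoint P₁ P₃ × Disjoint P₂ P₃ ×
     NoEdges P₁ P₂ × NoEdges P₁ P₃ × NoEdges P₂ P₃)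

  ThetaFree : Set
  ThetaFree = ¬ HasTheta

  IsClique : List V → Set
  IsClique S = ∀ x y → x ∈ S → y ∈ S → x ≢ y → Adj x y

  data Reach (S : List V) : V → V → Set where
    here : ∀ {u} → u ∉ S → Reach S u u
    step : ∀ {u w v} → u ∉ S → Adj u w → Reach S w v → Reach S u v

  Separates : List V → Set
  Separates S = ∃[ u ] ∃[ v ] (u ∉ S × v ∉ S × ¬ Reach S u v)

  IsCliqueSeparator : List V → Set
  IsCliqueSeparator S = IsClique S × Separates S

  Atomic : Set
  Atomic = ∀ S → ¬ IsCliqueSeparator S

  GoodP3 : V → V → V → Set
  GoodP3 a c b = ∀ int → ABPath a int b → c ∉ int →
    ∀ x → x ∈ int → ¬ Adj x c

{-# OPTIONS --safe #-}
-- If acb is good, atomicity gives an ab-path in G ∖ c, and a shortest one closes with c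
-- into a hole; a wheel (H, c) through a and b, or (H, c′) through a, c, b with c ~ c′,
-- would give an ab-path avoiding c through a neighbour of c (for c′: the detour through
-- c′ between its first and last neighbours on the hole).
--
-- Conversely, write the hole as c a q b and let P be an ab-path in G ∖ c through a
-- neighbour x of c. A neighbour of c off the hole has no neighbour on it: two of them
-- give a wheel at a neighbour of c, a single one a theta. Walking along P from x, the
-- first vertex touching the hole is reached from c by a path outside the hole, so a
-- theta appears unless it attaches only at a or at b, which P, being induced, forbids.
-- Hence the interior of P is far from q, and P together with b q a is a hole on which
-- c sees a, b and x: a wheel (H, c) with a, b ∈ H.
module Submission where

open import Defs
open import Data.Bool using (true; false)
import Data.Bool as Bool
open import Data.Empty using (⊥; ⊥-elim)
open import Data.Fin using (Fin; toℕ; _≟_) renaming (zero to fzero; suc to fsuc)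
open import Data.Fin.Properties using (any?; injective⇒≤; toℕ-injective)
open import Data.List using (List; []; _∷_; _++_; [_]; length; lookup; reverse; initLast; _∷ʳ′_)
open import Data.List.Properties
  using ( ++-assoc; ++-identityʳ; ++-conicalʳ; ∷-injective; ∷-injectiveˡ; ∷-injectiveʳ
        ; ∷ʳ-injective; ∷ʳ-injectiveʳ; unfold-reverse; reverse-++; reverse-involutive )
open import Data.List.Membership.Propositional using (_∈_; _∉_; find)
open import Data.List.Membership.Propositional.Properties
  using (∈-lookup; ∈-++⁺ˡ; ∈-++⁺ʳ; ∈-++⁻; ∈-∃++)
import Data.List.Membership.DecPropositional as DecMembership
open import Data.List.Relation.Unary.All as All using (All; []; _∷_)
open import Data.List.Relation.Unary.All.Properties using (++⁺; ++⁻ˡ; ++⁻ʳ; ¬Any⇒All¬; All¬⇒¬Any)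
open import Data.List.Relation.Unary.Any as Any using (Any; here; there)
open import Data.List.Relation.Unary.Any.Properties
  using (lookup-index) renaming (++⁺ˡ to Any-++⁺ˡ; ++⁺ʳ to Any-++⁺ʳ)
import Data.List.Relation.Binary.Permutation.Propositional as ↭
open ↭ using (_↭_; ↭-sym; ↭-trans)
open import Data.List.Relation.Binary.Permutation.Propositional.Properties
  using (All-resp-↭; ∈-resp-↭; ↭-reverse; shift) renaming (++-comm to ↭-++-comm)
open import Data.Nat using (ℕ; zero; suc; _+_; _≤_; z≤n; s≤s)
import Data.Nat as ℕ
open import Data.Nat.Properties
  using (suc-injective; +-identityʳ; ≤-refl; ≤-trans; n≤1+n; m≤m+n; m≤n+m; <⇒≱; module ≤-Reasoning)
open import Algebra.Properties.CommutativeSemigroup Data.Nat.Properties.+-commutativeSemigroup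
  using (x∙yz≈y∙xz)
import Data.Product as Product
open import Data.Product using (Σ; ∃-syntax; _×_; _,_; proj₁; proj₂)
import Data.Sum as Sum
open import Data.Sum using (_⊎_; inj₁; inj₂)
open import Data.Unit using (⊤; tt)
open import Function using (_∘_; case_of_)
open import Function.Bundles using (_⇔_; mk⇔)
open import Relation.Nullary using (¬_; Dec; yes; no)
open import Relation.Nullary.Decidable using (¬?; _×-dec_; _⊎-dec_)
open import Relation.Unary using (Decidable)
open import Relation.Binary.PropositionalEquality
  using (_≡_; _≢_; refl; sym; trans; cong; cong₂; subst; module ≡-Reasoning)

module _ {A : Set} where

  length-∷ʳ : ∀ (xs : List A) z → length (xs ++ [ z ]) ≡ suc (length xs)
  length-∷ʳ []       z = refl
  length-∷ʳ (x ∷ xs) z = cong suc (length-∷ʳ xs z)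

  lookup-∷ʳ : ∀ (xs : List A) z k →
              lookup (xs ++ [ z ]) k ∈ xs ⊎ (lookup (xs ++ [ z ]) k ≡ z × toℕ k ≡ length xs)
  lookup-∷ʳ []       z fzero    = inj₂ (refl , refl)
  lookup-∷ʳ (x ∷ xs) z fzero    = inj₁ (here refl)
  lookup-∷ʳ (x ∷ xs) z (fsuc k) =
    Sum.map there (Product.map₂ (cong suc)) (lookup-∷ʳ xs z k)

  lookup-∷ʳ-last : ∀ (xs : List A) z k → toℕ k ≡ length xs → lookup (xs ++ [ z ]) k ≡ z
  lookup-∷ʳ-last []       z fzero    _ = refl
  lookup-∷ʳ-last (x ∷ xs) z (fsuc k) e = lookup-∷ʳ-last xs z k (suc-injective e)

  last-index : ∀ (xs : List A) z → Σ (Fin (length (xs ++ [ z ]))) λ k → toℕ k ≡ length xs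
  last-index []       z = fzero , refl
  last-index (x ∷ xs) z = Product.map fsuc (cong suc) (last-index xs z)

  reverse-∷ʳ : ∀ (xs : List A) z → reverse (xs ++ [ z ]) ≡ z ∷ reverse xs
  reverse-∷ʳ xs z = reverse-++ xs [ z ]

  reverse-ends : ∀ y (xs : List A) z → reverse (y ∷ xs ++ [ z ]) ≡ z ∷ reverse xs ++ [ y ]
  reverse-ends y xs z = trans (unfold-reverse y (xs ++ [ z ])) (cong (_++ [ y ]) (reverse-∷ʳ xs z))

  reverse-≢[] : ∀ (xs : List A) → xs ≢ [] → reverse xs ≢ []
  reverse-≢[] xs xs≢[] e = xs≢[] (trans (sym (reverse-involutive xs)) (cong reverse e))

  reverse-middle : ∀ (xs : List A) y ys → reverse (xs ++ y ∷ ys) ≡ reverse ys ++ y ∷ reverse xs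
  reverse-middle xs y ys = trans (reverse-++ xs (y ∷ ys))
    (trans (cong (_++ reverse xs) (unfold-reverse y ys)) (++-assoc (reverse ys) [ y ] (reverse xs)))

  ∉-detour : ∀ {w u : A} xs y₁ ms y₂ ys → w ∉ xs ++ y₁ ∷ ms ++ y₂ ∷ ys → w ≢ u →
             w ∉ xs ++ y₁ ∷ u ∷ y₂ ∷ ys
  ∉-detour xs y₁ ms y₂ ys w∉ w≢u w∈ with ∈-++⁻ xs w∈
  ... | inj₁ w∈xs                   = w∉ (∈-++⁺ˡ w∈xs)
  ... | inj₂ (here refl)            = w∉ (∈-++⁺ʳ xs (here refl))
  ... | inj₂ (there (here refl))    = w≢u refl
  ... | inj₂ (there (there w∈y₂ys)) = w∉ (∈-++⁺ʳ xs (there (∈-++⁺ʳ ms w∈y₂ys)))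

  ∷ʳ-split : ∀ {y z : A} xs ys zs → xs ++ [ z ] ≡ ys ++ y ∷ zs → y ≢ z →
             ∃[ zs′ ] (zs ≡ zs′ ++ [ z ] × xs ≡ ys ++ y ∷ zs′)
  ∷ʳ-split xs ys zs e y≢z with initLast zs
  ... | [] = ⊥-elim (y≢z (sym (∷ʳ-injectiveʳ xs ys e)))
  ... | zs′ ∷ʳ′ w with ∷ʳ-injective xs (ys ++ _ ∷ zs′) (trans e (sym (++-assoc ys (_ ∷ zs′) [ w ])))
  ...   | xs≡ , refl = zs′ , refl , xs≡

  ∷ʳ-prefix : ∀ {z : A} xs X Y → xs ++ [ z ] ≡ X ++ Y → Y ≢ [] → ∃[ Y′ ] (xs ≡ X ++ Y′)
  ∷ʳ-prefix xs       []      Y e Y≢[] = xs , refl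
  ∷ʳ-prefix []       (_ ∷ X) Y e Y≢[] = ⊥-elim (Y≢[] (++-conicalʳ X Y (sym (∷-injectiveʳ e))))
  ∷ʳ-prefix (x ∷ xs) (_ ∷ X) Y e Y≢[] with refl , e′ ← ∷-injective e =
    Product.map₂ (cong (x ∷_)) (∷ʳ-prefix xs X Y e′ Y≢[])

  All-reverse : ∀ {P : A → Set} {xs} → All P xs → All P (reverse xs)
  All-reverse {xs = xs} = All-resp-↭ (↭-sym (↭-reverse xs))

  reverse-∷ʳ-↭ : ∀ (xs : List A) x → reverse xs ++ [ x ] ↭ x ∷ xs
  reverse-∷ʳ-↭ xs x = subst (_↭ x ∷ xs) (unfold-reverse x xs) (↭-reverse (x ∷ xs))

  ∷-reverse-↭ : ∀ (xs : List A) x → x ∷ reverse xs ↭ xs ++ [ x ]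
  ∷-reverse-↭ xs x = subst (_↭ xs ++ [ x ]) (reverse-∷ʳ xs x) (↭-reverse (xs ++ [ x ]))

  ++-∷-≢[] : ∀ (xs : List A) y ys → xs ++ y ∷ ys ≢ []
  ++-∷-≢[] xs y ys e with () ← ++-conicalʳ xs (y ∷ ys) e

module _ {A : Set} (P : A → Set) where

  data FirstSplit (xs : List A) : Set where
    first-at : ∀ before y after → xs ≡ before ++ y ∷ after →
               All (¬_ ∘ P) before → P y → FirstSplit xs

  data LastSplit (xs : List A) : Set where
    last-at : ∀ before y after → xs ≡ before ++ y ∷ after →
              P y → All (¬_ ∘ P) after → LastSplit xs

module _ {A : Set} {P : A → Set} (P? : Decidable P) where

  first-split : ∀ {xs} → Any P xs → FirstSplit P xs
  first-split {x ∷ xs} px with P? x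
  ... | yes p = first-at [] x xs refl [] p
  first-split {x ∷ xs} (here p)   | no ¬p = ⊥-elim (¬p p)
  first-split {x ∷ xs} (there px) | no ¬p with first-split px
  ... | first-at A y B refl ¬A py = first-at (x ∷ A) y B refl (¬p ∷ ¬A) py

  last-split : ∀ {xs} → Any P xs → LastSplit P xs
  last-split {x ∷ xs} px with Any.any? P? xs
  ... | yes pxs with last-split pxs
  ...   | last-at A y B refl py ¬B = last-at (x ∷ A) y B refl py ¬B
  last-split {x ∷ xs} (here p)   | no ¬pxs = last-at [] x xs refl p (¬Any⇒All¬ xs ¬pxs)
  last-split {x ∷ xs} (there px) | no ¬pxs = ⊥-elim (¬pxs px)

module Graphs {n : ℕ} (G : Graph n) where

  open DecMembership (_≟_ {n}) using (_∈?_)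

  infix 4 _~_
  _~_ : V G → V G → Set
  _~_ = Adj G

  ~-sym : ∀ {x y} → x ~ y → y ~ x
  ~-sym {x} {y} = trans (Graph.sym G y x)

  ~-irrefl : ∀ {x y} → x ~ y → x ≢ y
  ~-irrefl {x} x~x refl with trans (sym x~x) (Graph.irrefl G x)
  ... | ()

  _~?_ : ∀ x y → Dec (x ~ y)
  x ~? y = Graph.E G x y Bool.≟ true

  Far : V G → V G → Set
  Far x y = x ≢ y × ¬ x ~ y

  Far-sym : ∀ {x y} → Far x y → Far y x
  Far-sym (x≢y , x≁y) = x≢y ∘ sym , x≁y ∘ ~-sym

  AllFar : List (V G) → List (V G) → Set
  AllFar xs ys = All (λ x → All (Far x) ys) xs

  Far⇒∉ : ∀ {x xs} → All (Far x) xs → x ∉ xs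
  Far⇒∉ far x∈ = proj₁ (All.lookup far x∈) refl

  AllFar-⊆ʳ : ∀ {xs ys zs} → (∀ {w} → w ∈ zs → w ∈ ys) → AllFar xs ys → AllFar xs zs
  AllFar-⊆ʳ zs⊆ys = All.map (λ far → All.tabulate (All.lookup far ∘ zs⊆ys))

  Anticomplete : V G → List (V G) → Set
  Anticomplete u = All (λ w → ¬ u ~ w)

  Touches : V G → V G → Set
  Touches u w = u ≡ w ⊎ u ~ w

  touches? : ∀ u w → Dec (Touches u w)
  touches? u w = u ≟ w ⊎-dec u ~? w

  ¬Touches⇒Far : ∀ {u w} → ¬ Touches u w → Far u w
  ¬Touches⇒Far ¬t = ¬t ∘ inj₁ , ¬t ∘ inj₂

  untouched⇒far : ∀ {u} L → ¬ Any (Touches u) L → All (Far u) L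
  untouched⇒far L ¬touch = All.map ¬Touches⇒Far (¬Any⇒All¬ L ¬touch)

  touches⇒adjacent : ∀ {u L} → u ∉ L → Any (Touches u) L → Any (u ~_) L
  touches⇒adjacent u∉L (here (inj₁ refl)) = ⊥-elim (u∉L (here refl))
  touches⇒adjacent u∉L (here (inj₂ u~w))  = here u~w
  touches⇒adjacent u∉L (there touch)      = there (touches⇒adjacent (u∉L ∘ there) touch)

  -- Induced paths

  -- The list-recursive form of IsPath.
  Precedes : V G → List (V G) → Set
  Precedes x []       = ⊤
  Precedes x (y ∷ ys) = x ~ y × x ≢ y × All (Far x) ys

  Induced : List (V G) → Set
  Induced []       = ⊤
  Induced (x ∷ xs) = Precedes x xs × Induced xs

  induced-++⁻ˡ : ∀ xs ys → Induced (xs ++ ys) → Induced xs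
  induced-++⁻ˡ []           ys _                       = tt
  induced-++⁻ˡ (x ∷ [])     ys _                       = tt , tt
  induced-++⁻ˡ (x ∷ y ∷ xs) ys ((x~y , x≢y , far) , p) =
    (x~y , x≢y , ++⁻ˡ xs far) , induced-++⁻ˡ (y ∷ xs) ys p

  induced-++⁻ʳ : ∀ xs ys → Induced (xs ++ ys) → Induced ys
  induced-++⁻ʳ []       ys p       = p
  induced-++⁻ʳ (x ∷ xs) ys (_ , p) = induced-++⁻ʳ xs ys p

  induced-infix : ∀ xs ys zs → Induced (xs ++ ys ++ zs) → Induced ys
  induced-infix xs ys zs = induced-++⁻ˡ ys zs ∘ induced-++⁻ʳ xs (ys ++ zs)

  induced-∷ʳ-adjacent : ∀ x xs t → Induced (x ∷ xs ++ [ t ]) → Any (_~ t) (x ∷ xs)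
  induced-∷ʳ-adjacent x []       t ((x~t , _) , _) = here x~t
  induced-∷ʳ-adjacent x (y ∷ xs) t (_ , p)         = there (induced-∷ʳ-adjacent y xs t p)

  induced-far : ∀ xs u ys → Induced (xs ++ u ∷ ys) → AllFar xs ys
  induced-far []           u ys _                   = []
  induced-far (x ∷ [])     u ys ((_ , _ , far) , _) = far ∷ []
  induced-far (x ∷ y ∷ xs) u ys ((_ , _ , far) , p) =
    All.tail (++⁻ʳ xs far) ∷ induced-far (y ∷ xs) u ys p

  induced-distinctˡ : ∀ xs u ys → Induced (xs ++ u ∷ ys) → All (_≢ u) xs
  induced-distinctˡ []           u ys _                   = []
  induced-distinctˡ (x ∷ [])     u ys ((_ , x≢u , _) , _) = x≢u ∷ []
  induced-distinctˡ (x ∷ y ∷ xs) u ys ((_ , _ , far) , p) =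
    proj₁ (All.head (++⁻ʳ xs far)) ∷ induced-distinctˡ (y ∷ xs) u ys p

  induced-distinctʳ : ∀ xs u ys → Induced (xs ++ u ∷ ys) → All (u ≢_) ys
  induced-distinctʳ xs u []       p = []
  induced-distinctʳ xs u (y ∷ ys) p with induced-++⁻ʳ xs (u ∷ y ∷ ys) p
  ... | (_ , u≢y , far) , _ = u≢y ∷ All.map proj₁ far

  induced-glue : ∀ xs u ys → Induced (xs ++ [ u ]) → Induced (u ∷ ys) →
                 AllFar xs ys → Induced (xs ++ u ∷ ys)
  induced-glue []           u ys _ q _ = q
  induced-glue (x ∷ [])     u ys ((x~u , x≢u , []) , _) q (far ∷ []) =
    (x~u , x≢u , far) , q
  induced-glue (x ∷ y ∷ xs) u ys ((x~y , x≢y , far) , p) q (far′ ∷ fars) =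
    (x~y , x≢y , ++⁺ (++⁻ˡ xs far) (All.head (++⁻ʳ xs far) ∷ far′)) ,
    induced-glue (y ∷ xs) u ys p q fars

  induced-∷ʳ : ∀ xs u w → Induced (xs ++ [ u ]) → u ~ w → u ≢ w →
               All (Far w) xs → Induced (xs ++ u ∷ [ w ])
  induced-∷ʳ xs u w p u~w u≢w far =
    induced-glue xs u [ w ] p ((u~w , u≢w , []) , tt , tt)
      (All.map (λ w-far → Far-sym w-far ∷ []) far)

  induced-reverse : ∀ xs → Induced xs → Induced (reverse xs)
  induced-reverse []           _ = tt
  induced-reverse (x ∷ [])     _ = tt , tt
  induced-reverse (x ∷ y ∷ ys) ((x~y , x≢y , far) , p) =
    subst Induced (sym (unfold-reverse x (y ∷ ys)))
      (subst (λ l → Induced (l ++ [ x ])) (sym (unfold-reverse y ys))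
        (subst Induced (sym (++-assoc (reverse ys) [ y ] [ x ]))
          (induced-∷ʳ (reverse ys) y x
            (subst Induced (unfold-reverse y ys) (induced-reverse (y ∷ ys) p))
            (~-sym x~y) (x≢y ∘ sym) (All-reverse far))))

  induced-far-apart : ∀ A y₁ M y₂ B → Induced (A ++ y₁ ∷ M ++ y₂ ∷ B) → ¬ y₁ ~ y₂ →
                      AllFar (A ++ [ y₁ ]) (y₂ ∷ B)
  induced-far-apart A y₁ M y₂ B p y₁≁y₂ =
    ++⁺ (All.map (++⁻ʳ M) (induced-far A y₁ (M ++ y₂ ∷ B) p))
        (((All.head (++⁻ʳ M (induced-distinctʳ A y₁ (M ++ y₂ ∷ B) p)) , y₁≁y₂) ∷
          All.lookup (induced-far (A ++ y₁ ∷ M) y₂ B p′) (∈-++⁺ʳ A (here refl))) ∷ [])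
    where
    p′ : Induced ((A ++ y₁ ∷ M) ++ y₂ ∷ B)
    p′ = subst Induced (sym (++-assoc A (y₁ ∷ M) (y₂ ∷ B))) p

  induced-detour : ∀ A y₁ M y₂ B {u} → Induced (A ++ y₁ ∷ M ++ y₂ ∷ B) →
                   u ~ y₁ → u ~ y₂ → ¬ y₁ ~ y₂ → u ∉ A ++ y₁ ∷ M ++ y₂ ∷ B →
                   Anticomplete u A → Anticomplete u B → Induced (A ++ y₁ ∷ u ∷ y₂ ∷ B)
  induced-detour A y₁ M y₂ B {u} p u~y₁ u~y₂ y₁≁y₂ u∉ ¬A ¬B =
    induced-glue A y₁ (u ∷ y₂ ∷ B)
      (induced-++⁻ˡ (A ++ [ y₁ ]) (M ++ y₂ ∷ B)
        (subst Induced (sym (++-assoc A [ y₁ ] (M ++ y₂ ∷ B))) p))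
      ((~-sym u~y₁ , u≢ y₁-in ∘ sym , All.head (++⁻ʳ A apart)) ,
       (u~y₂ , u≢ y₂-in , All.tabulate (λ w∈B → u≢ (B-in w∈B) , All.lookup ¬B w∈B)) ,
       induced-++⁻ʳ (A ++ y₁ ∷ M) (y₂ ∷ B)
         (subst Induced (sym (++-assoc A (y₁ ∷ M) (y₂ ∷ B))) p))
      (All.zipWith (λ (far-u , far-y₂B) → far-u ∷ far-y₂B)
        (All.tabulate (λ w∈A → Far-sym (u≢ (∈-++⁺ˡ w∈A) , All.lookup ¬A w∈A)) , ++⁻ˡ A apart))
    where
    apart = induced-far-apart A y₁ M y₂ B p y₁≁y₂
    u≢ : ∀ {w} → w ∈ A ++ y₁ ∷ M ++ y₂ ∷ B → u ≢ w
    u≢ w∈ refl = u∉ w∈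
    y₁-in = ∈-++⁺ʳ A (here refl)
    y₂-in = ∈-++⁺ʳ A (there (∈-++⁺ʳ M (here refl)))
    B-in : ∀ {w} → w ∈ B → w ∈ A ++ y₁ ∷ M ++ y₂ ∷ B
    B-in w∈B = ∈-++⁺ʳ A (there (∈-++⁺ʳ M (there w∈B)))

  c-path-from-last-nbr : ∀ {c} F t → Induced (F ++ [ t ]) → c ∉ F ++ [ t ] → ¬ c ~ t →
                         Any (_~ c) F →
                         ∃[ s ] ∃[ F₂ ] (Induced (c ∷ s ∷ F₂ ++ [ t ]) × (∀ {w} → w ∈ s ∷ F₂ → w ∈ F))
  c-path-from-last-nbr {c} F t p c∉ c≁t some with last-split (_~? c) some
  ... | last-at F₁ s F₂ refl s~c ¬F₂ =
    s , F₂ ,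
    ((~-sym s~c , c≢ (in-F (here refl)) ,
      ++⁺ (All.tabulate λ w∈F₂ → c≢ (in-F (there w∈F₂)) , All.lookup ¬F₂ w∈F₂ ∘ ~-sym)
          ((c≢ (∈-++⁺ʳ (F₁ ++ s ∷ F₂) (here refl)) , c≁t) ∷ [])) ,
     induced-++⁻ʳ F₁ (s ∷ F₂ ++ [ t ]) (subst Induced (++-assoc F₁ (s ∷ F₂) [ t ]) p)) ,
    ∈-++⁺ʳ F₁
    where
    in-F : ∀ {w} → w ∈ s ∷ F₂ → w ∈ (F₁ ++ s ∷ F₂) ++ [ t ]
    in-F = ∈-++⁺ˡ ∘ ∈-++⁺ʳ F₁
    c≢ : ∀ {w} → w ∈ (F₁ ++ s ∷ F₂) ++ [ t ] → c ≢ w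
    c≢ w∈ refl = c∉ w∈

  IsPath-tail : ∀ x xs → IsPath G (x ∷ xs) → IsPath G xs
  IsPath-tail x xs (distinct , adjacent , chordless) =
    (λ i j i≢j → distinct (fsuc i) (fsuc j) (i≢j ∘ suc-injective)) ,
    (λ i j j≡1+i → adjacent (fsuc i) (fsuc j) (cong suc j≡1+i)) ,
    (λ i j i~j → Sum.map suc-injective suc-injective (chordless (fsuc i) (fsuc j) i~j))

  IsPath⇒Induced : ∀ xs → IsPath G xs → Induced xs
  IsPath⇒Induced []           _ = tt
  IsPath⇒Induced (x ∷ [])     _ = tt , tt
  IsPath⇒Induced (x ∷ y ∷ ys) p@(distinct , adjacent , chordless) =
    (adjacent fzero (fsuc fzero) refl , distinct fzero (fsuc fzero) (λ ()) , All.tabulate far) ,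
    IsPath⇒Induced (y ∷ ys) (IsPath-tail x (y ∷ ys) p)
    where
    far : ∀ {z} → z ∈ ys → Far x z
    far z∈ys with k ← Any.index z∈ys | refl ← lookup-index z∈ys =
      distinct fzero (fsuc (fsuc k)) (λ ()) ,
      λ x~z → case chordless fzero (fsuc (fsuc k)) x~z of λ { (inj₁ ()) ; (inj₂ ()) }

  precedes-distinct : ∀ {x xs} → Precedes x xs → ∀ j → x ≢ lookup xs j
  precedes-distinct {xs = y ∷ ys} (_ , x≢y , _)  fzero    = x≢y
  precedes-distinct {xs = y ∷ ys} (_ , _ , far) (fsuc k) = proj₁ (All.lookup far (∈-lookup k))

  precedes-first : ∀ {x xs} → Precedes x xs → ∀ j → toℕ j ≡ 0 → x ~ lookup xs j
  precedes-first {xs = y ∷ ys} (x~y , _) fzero _ = x~y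

  precedes-only-first : ∀ {x xs} → Precedes x xs → ∀ j → x ~ lookup xs j → toℕ j ≡ 0
  precedes-only-first {xs = y ∷ ys} _             fzero    _   = refl
  precedes-only-first {xs = y ∷ ys} (_ , _ , far) (fsuc k) x~z =
    ⊥-elim (proj₂ (All.lookup far (∈-lookup k)) x~z)

  Induced⇒IsPath : ∀ xs → Induced xs → IsPath G xs
  Induced⇒IsPath []       _      = (λ ()) , (λ ()) , (λ ())
  Induced⇒IsPath (x ∷ xs) (h , p) = distinct , adjacent , chordless
    where
    tail-path : IsPath G xs
    tail-path = Induced⇒IsPath xs p


    distinct : ∀ i j → toℕ i ≢ toℕ j → lookup (x ∷ xs) i ≢ lookup (x ∷ xs) j
    distinct fzero    fzero    i≢j = ⊥-elim (i≢j refl)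
    distinct fzero    (fsuc j) _   = precedes-distinct h j
    distinct (fsuc i) fzero    _   = precedes-distinct h i ∘ sym
    distinct (fsuc i) (fsuc j) i≢j = proj₁ tail-path i j (i≢j ∘ cong suc)

    adjacent : ∀ i j → toℕ j ≡ suc (toℕ i) → lookup (x ∷ xs) i ~ lookup (x ∷ xs) j
    adjacent fzero    (fsuc j) e = precedes-first h j (suc-injective e)
    adjacent (fsuc i) (fsuc j) e = proj₁ (proj₂ tail-path) i j (suc-injective e)

    chordless : ∀ i j → lookup (x ∷ xs) i ~ lookup (x ∷ xs) j →
                toℕ j ≡ suc (toℕ i) ⊎ toℕ i ≡ suc (toℕ j)
    chordless fzero    fzero    x~x = ⊥-elim (~-irrefl x~x refl)
    chordless fzero    (fsuc j) x~z = inj₁ (cong suc (precedes-only-first h j x~z))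
    chordless (fsuc i) fzero    z~x = inj₂ (cong suc (precedes-only-first h i (~-sym z~x)))
    chordless (fsuc i) (fsuc j) i~j =
      Sum.map (cong suc) (cong suc) (proj₂ (proj₂ tail-path) i j i~j)

  -- Holes

  IsEnd : List (V G) → ℕ → Set
  IsEnd K j = j ≡ 0 ⊎ suc j ≡ length K

  record Closes (x : V G) (K : List (V G)) : Set where
    field
      path       : IsPath G K
      long       : 3 ≤ length K
      outside    : ∀ j → x ≢ lookup K j
      ends-adj   : ∀ j → IsEnd K (toℕ j) → x ~ lookup K j
      only-ends  : ∀ j → x ~ lookup K j → IsEnd K (toℕ j)

  Closes⇒IsHole : ∀ x K → Closes x K → IsHole G (x ∷ K)
  Closes⇒IsHole x K c = s≤s long , distinct , adjacent , chordless
    where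
    open Closes c

    distinct : ∀ i j → toℕ i ≢ toℕ j → lookup (x ∷ K) i ≢ lookup (x ∷ K) j
    distinct fzero    fzero    i≢j = ⊥-elim (i≢j refl)
    distinct fzero    (fsuc j) _   = outside j
    distinct (fsuc i) fzero    _   = outside i ∘ sym
    distinct (fsuc i) (fsuc j) i≢j = proj₁ path i j (i≢j ∘ cong suc)

    adjacent : ∀ i j → CycNext G (length (x ∷ K)) (toℕ i) (toℕ j) →
               lookup (x ∷ K) i ~ lookup (x ∷ K) j
    adjacent fzero    fzero    (inj₁ ())
    adjacent fzero    fzero    (inj₂ (_ , e)) with () ← subst (3 ≤_) (suc-injective (sym e)) long
    adjacent fzero    (fsuc j) (inj₁ e)       = ends-adj j (inj₁ (suc-injective e))
    adjacent fzero    (fsuc j) (inj₂ (_ , e)) = ends-adj j (inj₂ (suc-injective e))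
    adjacent (fsuc i) fzero    (inj₁ ())
    adjacent (fsuc i) fzero    (inj₂ (() , _))
    adjacent (fsuc i) (fsuc j) (inj₁ e)       = proj₁ (proj₂ path) i j (suc-injective e)
    adjacent (fsuc i) (fsuc j) (inj₂ (() , _))

    next : ∀ {j} → IsEnd K j → CycNext G (length (x ∷ K)) 0 (suc j)
    next (inj₁ e) = inj₁ (cong suc e)
    next (inj₂ e) = inj₂ (refl , cong suc e)

    chordless : ∀ i j → lookup (x ∷ K) i ~ lookup (x ∷ K) j →
                CycNext G (length (x ∷ K)) (toℕ i) (toℕ j) ⊎
                CycNext G (length (x ∷ K)) (toℕ j) (toℕ i)
    chordless fzero    fzero    x~x = ⊥-elim (~-irrefl x~x refl)
    chordless fzero    (fsuc j) x~z = inj₁ (next (only-ends j x~z))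
    chordless (fsuc i) fzero    z~x = inj₂ (next (only-ends i (~-sym z~x)))
    chordless (fsuc i) (fsuc j) i~j =
      Sum.map (inj₁ ∘ cong suc) (inj₁ ∘ cong suc) (proj₂ (proj₂ path) i j i~j)

  IsHole⇒Closes : ∀ x K → IsHole G (x ∷ K) → Closes x K
  IsHole⇒Closes x K (s≤s long , distinct , adjacent , chordless) = record
    { path      = (λ i j i≢j → distinct (fsuc i) (fsuc j) (i≢j ∘ suc-injective)) ,
                  (λ i j e → adjacent (fsuc i) (fsuc j) (inj₁ (cong suc e))) ,
                  inner-chordless
    ; long      = long
    ; outside   = λ j → distinct fzero (fsuc j) (λ ())
    ; ends-adj  = λ { j (inj₁ e) → adjacent fzero (fsuc j) (inj₁ (cong suc e))
                    ; j (inj₂ e) → adjacent fzero (fsuc j) (inj₂ (refl , cong suc e)) }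
    ; only-ends = only-ends
    }
    where
    inner-chordless : ∀ i j → lookup K i ~ lookup K j →
                      toℕ j ≡ suc (toℕ i) ⊎ toℕ i ≡ suc (toℕ j)
    inner-chordless i j i~j with chordless (fsuc i) (fsuc j) i~j
    ... | inj₁ (inj₁ e) = inj₁ (suc-injective e)
    ... | inj₂ (inj₁ e) = inj₂ (suc-injective e)

    only-ends : ∀ j → x ~ lookup K j → IsEnd K (toℕ j)
    only-ends j x~z with chordless fzero (fsuc j) x~z
    ... | inj₁ (inj₁ e)       = inj₁ (suc-injective e)
    ... | inj₁ (inj₂ (_ , e)) = inj₂ (suc-injective e)
    ... | inj₂ (inj₁ ())
    ... | inj₂ (inj₂ (() , _))

  -- The hole x, y, m, z (in cyclic order), rooted at x.
  record Hole (x y : V G) (m : List (V G)) (z : V G) : Set where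
    field
      rooted  : Induced (x ∷ y ∷ m)
      path    : Induced (y ∷ m ++ [ z ])
      closing : x ~ z
      x≢z     : x ≢ z
      long    : m ≢ []

    x~y : x ~ y
    x~y = proj₁ (proj₁ rooted)

    x≢y : x ≢ y
    x≢y = proj₁ (proj₂ (proj₁ rooted))

    x-far-m : All (Far x) m
    x-far-m = proj₂ (proj₂ (proj₁ rooted))

  Hole⇒Closes : ∀ x y m z → Hole x y m z → Closes x (y ∷ m ++ [ z ])
  Hole⇒Closes x y m z h = record
    { path      = Induced⇒IsPath _ path
    ; long      = long-enough m long
    ; outside   = λ j → outside′ (∈-lookup j)
    ; ends-adj  = ends-adj
    ; only-ends = only-ends
    }
    where
    open Hole h

    long-enough : ∀ m → m ≢ [] → 3 ≤ length (y ∷ m ++ [ z ])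
    long-enough []      m≢[] = ⊥-elim (m≢[] refl)
    long-enough (w ∷ m) _    = s≤s (s≤s (subst (1 ≤_) (sym (length-∷ʳ m z)) (s≤s z≤n)))

    outside′ : ∀ {w} → w ∈ y ∷ m ++ [ z ] → x ≢ w
    outside′ (here refl) = x≢y
    outside′ (there w∈) with ∈-++⁻ m w∈
    ... | inj₁ w∈m         = proj₁ (All.lookup x-far-m w∈m)
    ... | inj₂ (here refl) = x≢z

    ends-adj : ∀ j → IsEnd (y ∷ m ++ [ z ]) (toℕ j) → x ~ lookup (y ∷ m ++ [ z ]) j
    ends-adj fzero    _        = x~y
    ends-adj (fsuc k) (inj₂ e) = subst (x ~_) (sym (lookup-∷ʳ-last m z k k≡m)) closing
      where
      k≡m = suc-injective (trans (suc-injective e) (length-∷ʳ m z))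

    only-ends : ∀ j → x ~ lookup (y ∷ m ++ [ z ]) j → IsEnd (y ∷ m ++ [ z ]) (toℕ j)
    only-ends fzero    _   = inj₁ refl
    only-ends (fsuc k) x~w with lookup-∷ʳ m z k
    ... | inj₁ w∈m     = ⊥-elim (proj₂ (All.lookup x-far-m w∈m) x~w)
    ... | inj₂ (_ , e) = inj₂ (cong suc (trans (cong suc e) (sym (length-∷ʳ m z))))

  Closes⇒Hole : ∀ x y m z → Closes x (y ∷ m ++ [ z ]) → Hole x y m z
  Closes⇒Hole x y m z c = record
    { rooted  = (ends-adj fzero (inj₁ refl) , outside fzero , All.tabulate x-far) ,
                induced-++⁻ˡ (y ∷ m) [ z ] path′
    ; path    = path′
    ; closing = subst (x ~_) last≡z (ends-adj (fsuc last) (inj₂ last-is-end))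
    ; x≢z     = λ x≡z → outside (fsuc last) (trans x≡z (sym last≡z))
    ; long    = m≢[] m long
    }
    where
    open Closes c
    path′ : Induced (y ∷ m ++ [ z ])
    path′ = IsPath⇒Induced _ path

    last = proj₁ (last-index m z)
    last≡z = lookup-∷ʳ-last m z last (proj₂ (last-index m z))
    last-is-end : suc (suc (toℕ last)) ≡ length (y ∷ m ++ [ z ])
    last-is-end = cong suc (trans (cong suc (proj₂ (last-index m z))) (sym (length-∷ʳ m z)))

    m≢[] : ∀ m → 3 ≤ length (y ∷ m ++ [ z ]) → m ≢ []
    m≢[] [] (s≤s (s≤s ())) refl

    x-far : ∀ {w} → w ∈ m → Far x w
    x-far w∈m with k ← Any.index (∈-++⁺ˡ {ys = [ z ]} w∈m)
                 | refl ← lookup-index (∈-++⁺ˡ {ys = [ z ]} w∈m) =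
      outside (fsuc k) , x≁w
      where
      x≁w : ¬ x ~ lookup (m ++ [ z ]) k
      x≁w x~w with only-ends (fsuc k) x~w
      ... | inj₂ e = All.lookup (induced-distinctˡ (y ∷ m) z [] path′) (there w∈m)
                       (lookup-∷ʳ-last m z k (suc-injective (trans (suc-injective e) (length-∷ʳ m z))))

  Hole⇒IsHole : ∀ {x y m z} → Hole x y m z → IsHole G (x ∷ y ∷ m ++ [ z ])
  Hole⇒IsHole {x} {y} {m} {z} = Closes⇒IsHole x _ ∘ Hole⇒Closes x y m z

  record RootedHole (L : List (V G)) : Set where
    constructor rooted-hole
    field
      {root first last} : V G
      middle : List (V G)
      shape  : L ≡ root ∷ first ∷ middle ++ [ last ]
      hole   : Hole root first middle last

  IsHole⇒RootedHole : ∀ L → IsHole G L → RootedHole L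
  IsHole⇒RootedHole (x ∷ y ∷ K) h with initLast K
  ... | m ∷ʳ′ z = rooted-hole m refl (Closes⇒Hole x y m z (IsHole⇒Closes x _ h))
  IsHole⇒RootedHole (x ∷ y ∷ []) (s≤s (s≤s ()) , _) | []
  IsHole⇒RootedHole (x ∷ [])     (s≤s () , _)
  IsHole⇒RootedHole []           (() , _)

  Hole-rotate : ∀ {x y w m z} → Hole x y (w ∷ m) z → Hole y w (m ++ [ z ]) x
  Hole-rotate {x} {y} {w} {m} {z} h = record
    { rooted  = path
    ; path    = subst (λ l → Induced (w ∷ l)) (sym (++-assoc m [ z ] [ x ]))
                  (induced-∷ʳ (w ∷ m) z x (proj₂ path) (~-sym closing) (x≢z ∘ sym) x-far-m)
    ; closing = ~-sym x~y
    ; x≢z     = x≢y ∘ sym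
    ; long    = λ m++z≡[] → case ++-conicalʳ m [ z ] m++z≡[] of λ ()
    }
    where open Hole h

  IsHole-rotate : ∀ x L → IsHole G (x ∷ L) → IsHole G (L ++ [ x ])
  IsHole-rotate x L h with IsHole⇒RootedHole (x ∷ L) h
  ... | rooted-hole []      refl rh = ⊥-elim (Hole.long rh refl)
  ... | rooted-hole (w ∷ m) refl rh = Hole⇒IsHole (Hole-rotate rh)

  IsHole-rotate-to : ∀ pre v post → IsHole G (pre ++ v ∷ post) → IsHole G (v ∷ post ++ pre)
  IsHole-rotate-to []        v post h = subst (λ l → IsHole G (v ∷ l)) (sym (++-identityʳ post)) h
  IsHole-rotate-to (p ∷ pre) v post h =
    subst (λ l → IsHole G (v ∷ l)) (++-assoc post [ p ] pre)
      (IsHole-rotate-to pre v (post ++ [ p ])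
        (subst (IsHole G) (++-assoc pre (v ∷ post) [ p ]) (IsHole-rotate p (pre ++ v ∷ post) h)))

  record HoleAt (v : V G) (H : List (V G)) : Set where
    constructor hole-at
    field
      {first last} : V G
      middle : List (V G)
      hole   : Hole v first middle last
      perm   : v ∷ first ∷ middle ++ [ last ] ↭ H

  root-at : ∀ {H v} → IsHole G H → v ∈ H → HoleAt v H
  root-at {H} {v} h v∈H with pre , post , refl ← ∈-∃++ v∈H
    with IsHole⇒RootedHole _ (IsHole-rotate-to pre v post h)
  ... | rooted-hole m shape rh with refl ← ∷-injectiveˡ shape =
    hole-at m rh (subst (_↭ pre ++ v ∷ post) shape (↭-++-comm (v ∷ post) pre))

  Hole-reflect : ∀ {x y m z} → Hole x y m z → Hole x z (reverse m) y
  Hole-reflect {x} {y} {m} {z} h = record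
    { rooted  = (closing , x≢z , All-reverse x-far-m) ,
                subst Induced (reverse-∷ʳ m z) (induced-reverse _ (proj₂ path))
    ; path    = subst Induced (reverse-ends y m z) (induced-reverse _ path)
    ; closing = x~y
    ; x≢z     = x≢y
    ; long    = reverse-≢[] m long
    }
    where open Hole h

  reflect-↭ : ∀ (x y : V G) m z → x ∷ z ∷ reverse m ++ [ y ] ↭ x ∷ y ∷ m ++ [ z ]
  reflect-↭ x y m z =
    subst (λ l → x ∷ l ↭ x ∷ y ∷ m ++ [ z ]) (reverse-ends y m z)
      (↭.prep x (↭-reverse (y ∷ m ++ [ z ])))

  Hole-root-nbrs : ∀ {x y m z w} → Hole x y m z → w ∈ x ∷ y ∷ m ++ [ z ] → x ~ w → w ≡ y ⊎ w ≡ z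
  Hole-root-nbrs h (here refl)        x~x = ⊥-elim (~-irrefl x~x refl)
  Hole-root-nbrs h (there (here w≡y)) _   = inj₁ w≡y
  Hole-root-nbrs {m = m} h (there (there w∈)) x~w with ∈-++⁻ m w∈
  ... | inj₁ w∈m        = ⊥-elim (proj₂ (All.lookup (Hole.x-far-m h) w∈m) x~w)
  ... | inj₂ (here w≡z) = inj₂ w≡z

  Hole-prefix : ∀ {x y m z} X Y → Hole x y m z → y ∷ m ++ [ z ] ≡ X ++ Y → Y ≢ [] →
                    Induced (x ∷ X)
  Hole-prefix {x} {y} {m} X Y h e Y≢[] with Y′ , ym≡ ← ∷ʳ-prefix (y ∷ m) X Y e Y≢[] =
    induced-++⁻ˡ (x ∷ X) Y′ (subst (Induced ∘ (x ∷_)) ym≡ (Hole.rooted h))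

  Hole-exit : ∀ {x y m z t} X w Y → Hole x y m z → y ∷ m ++ [ z ] ≡ X ++ w ∷ Y → Y ≢ [] →
              w ~ t → t ≢ w → All (Far t) (x ∷ X) → Induced (x ∷ (X ++ [ w ]) ++ [ t ])
  Hole-exit {x} {t = t} X w Y h e Y≢[] w~t t≢w far =
    subst (Induced ∘ (x ∷_)) (sym (++-assoc X [ w ] [ t ]))
      (induced-∷ʳ (x ∷ X) w t (Hole-prefix (X ++ [ w ]) Y h (trans e (sym (++-assoc X [ w ] Y))) Y≢[])
        w~t (t≢w ∘ sym) far)

  Hole-arc : ∀ {x y m z} m₁ w m₂ → Hole x y m z → m ≡ m₁ ++ w ∷ m₂ → Induced (x ∷ y ∷ m₁ ++ [ w ])
  Hole-arc {x} {y} m₁ w m₂ h refl =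
    induced-++⁻ˡ (x ∷ y ∷ m₁ ++ [ w ]) m₂
      (subst (λ l → Induced (x ∷ y ∷ l)) (sym (++-assoc m₁ [ w ] m₂)) (Hole.rooted h))

  paths⇒IsHole : ∀ {a b} I J → Induced (a ∷ I ++ [ b ]) → Induced (a ∷ J ++ [ b ]) →
                 AllFar I J → I ≢ [] → J ≢ [] → IsHole G (a ∷ I ++ b ∷ reverse J)
  paths⇒IsHole []       _        _ _ _ I≢[] _    = ⊥-elim (I≢[] refl)
  paths⇒IsHole (_ ∷ _)  []       _ _ _ _    J≢[] = ⊥-elim (J≢[] refl)
  paths⇒IsHole {a} {b} (y ∷ I′) (j ∷ J′) pI pJ far _ _ =
    subst (IsHole G ∘ (a ∷_) ∘ (y ∷_)) (sym reshape) (Hole⇒IsHole hole)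
    where
    reshape : I′ ++ b ∷ reverse (j ∷ J′) ≡ (I′ ++ b ∷ reverse J′) ++ [ j ]
    reshape = trans (cong (λ l → I′ ++ b ∷ l) (unfold-reverse j J′))
                    (sym (++-assoc I′ (b ∷ reverse J′) [ j ]))
    b-path : ∀ K → Induced (K ++ [ b ]) → Induced (b ∷ reverse K)
    b-path K p = subst Induced (reverse-∷ʳ K b) (induced-reverse _ p)
    hole : Hole a y (I′ ++ b ∷ reverse J′) j
    hole = record
      { rooted  = induced-glue (a ∷ y ∷ I′) b (reverse J′) pI (b-path J′ (proj₂ (proj₂ pJ)))
                    (All-reverse (++⁻ˡ J′ (proj₂ (proj₂ (proj₁ pJ)))) ∷
                     All.map (λ v-far → All-reverse (All.tail v-far)) far)
      ; path    = subst Induced (cong (y ∷_) reshape)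
                    (induced-glue (y ∷ I′) b (reverse (j ∷ J′)) (proj₂ pI) (b-path (j ∷ J′) (proj₂ pJ))
                      (All.map All-reverse far))
      ; closing = proj₁ (proj₁ pJ)
      ; x≢z     = proj₁ (proj₂ (proj₁ pJ))
      ; long    = ++-∷-≢[] I′ b (reverse J′)
      }

  countNbrs-∷-adj : ∀ {u v} xs → u ~ v → countNbrs G u (v ∷ xs) ≡ suc (countNbrs G u xs)
  countNbrs-∷-adj xs u~v rewrite u~v = refl

  countNbrs-∷-nonadj : ∀ {u v} xs → ¬ u ~ v → countNbrs G u (v ∷ xs) ≡ countNbrs G u xs
  countNbrs-∷-nonadj {u} {v} xs u≁v with Graph.E G u v
  ... | true  = ⊥-elim (u≁v refl)
  ... | false = refl

  countNbrs-∷-≤ : ∀ u v xs → countNbrs G u (v ∷ xs) ≤ suc (countNbrs G u xs)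
  countNbrs-∷-≤ u v xs with Graph.E G u v
  ... | true  = ≤-refl
  ... | false = n≤1+n _

  countNbrs-++ : ∀ u xs ys → countNbrs G u (xs ++ ys) ≡ countNbrs G u xs + countNbrs G u ys
  countNbrs-++ u []       ys = refl
  countNbrs-++ u (x ∷ xs) ys with Graph.E G u x
  ... | true  = cong suc (countNbrs-++ u xs ys)
  ... | false = countNbrs-++ u xs ys

  countNbrs-↭ : ∀ u {xs ys} → xs ↭ ys → countNbrs G u xs ≡ countNbrs G u ys
  countNbrs-↭ u ↭.refl = refl
  countNbrs-↭ u (↭.prep x p) with Graph.E G u x
  ... | true  = cong suc (countNbrs-↭ u p)
  ... | false = countNbrs-↭ u p
  countNbrs-↭ u (↭.swap {xs} {ys} x y p) = begin
    countNbrs G u (x ∷ y ∷ xs)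
      ≡⟨ countNbrs-++ u [ x ] (y ∷ xs) ⟩
    #[ x ] + countNbrs G u (y ∷ xs)
      ≡⟨ cong (#[ x ] +_) (countNbrs-++ u [ y ] xs) ⟩
    #[ x ] + (#[ y ] + countNbrs G u xs)
      ≡⟨ x∙yz≈y∙xz #[ x ] #[ y ] (countNbrs G u xs) ⟩
    #[ y ] + (#[ x ] + countNbrs G u xs)
      ≡⟨ cong (λ k → #[ y ] + (#[ x ] + k)) (countNbrs-↭ u p) ⟩
    #[ y ] + (#[ x ] + countNbrs G u ys)
      ≡⟨ cong (#[ y ] +_) (countNbrs-++ u [ x ] ys) ⟨
    #[ y ] + countNbrs G u (x ∷ ys)
      ≡⟨ countNbrs-++ u [ y ] (x ∷ ys) ⟨
    countNbrs G u (y ∷ x ∷ ys)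
      ∎
    where
    open ≡-Reasoning
    #[_] : V G → ℕ
    #[ v ] = countNbrs G u [ v ]
  countNbrs-↭ u (↭.trans p q) = trans (countNbrs-↭ u p) (countNbrs-↭ u q)

  countNbrs-none : ∀ u xs → Anticomplete u xs → countNbrs G u xs ≡ 0
  countNbrs-none u []       []           = refl
  countNbrs-none u (x ∷ xs) (u≁x ∷ u≁xs) = trans (countNbrs-∷-nonadj xs u≁x) (countNbrs-none u xs u≁xs)

  countNbrs-any : ∀ u xs → Any (u ~_) xs → 1 ≤ countNbrs G u xs
  countNbrs-any u (x ∷ xs) (here u~x) = subst (1 ≤_) (sym (countNbrs-∷-adj xs u~x)) (s≤s z≤n)
  countNbrs-any u (x ∷ xs) (there p) with Graph.E G u x
  ... | true  = s≤s z≤n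
  ... | false = countNbrs-any u xs p

  countNbrs-≤2 : ∀ u x I y J → Anticomplete u I → Anticomplete u J →
                 countNbrs G u (x ∷ I ++ y ∷ J) ≤ 2
  countNbrs-≤2 u x I y J ¬I ¬J = begin
    countNbrs G u (x ∷ I ++ y ∷ J)              ≤⟨ countNbrs-∷-≤ u x (I ++ y ∷ J) ⟩
    suc (countNbrs G u (I ++ y ∷ J))            ≡⟨ cong suc (countNbrs-++ u I (y ∷ J)) ⟩
    suc (countNbrs G u I + countNbrs G u (y ∷ J)) ≡⟨ cong (λ k → suc (k + _)) (countNbrs-none u I ¬I) ⟩
    suc (countNbrs G u (y ∷ J))                 ≤⟨ s≤s (countNbrs-∷-≤ u y J) ⟩
    suc (suc (countNbrs G u J))                 ≡⟨ cong (suc ∘ suc) (countNbrs-none u J ¬J) ⟩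
    2                                           ∎
    where open ≤-Reasoning

  countNbrs-≥3 : ∀ u x I y J → u ~ x → u ~ y → Any (u ~_) I → 3 ≤ countNbrs G u (x ∷ I ++ y ∷ J)
  countNbrs-≥3 u x I y J u~x u~y u~I = begin
    3                                         ≤⟨ s≤s (s≤s (countNbrs-any u I u~I)) ⟩
    suc (suc (countNbrs G u I))               ≤⟨ s≤s (s≤s (m≤m+n _ _)) ⟩
    suc (suc (countNbrs G u I + countNbrs G u J)) ≡⟨ cong (suc ∘ suc) (countNbrs-++ u I J) ⟨
    suc (suc (countNbrs G u (I ++ J)))        ≡⟨ cong suc (countNbrs-∷-adj (I ++ J) u~y) ⟨
    suc (countNbrs G u (y ∷ I ++ J))          ≡⟨ countNbrs-∷-adj (y ∷ I ++ J) u~x ⟨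
    countNbrs G u (x ∷ y ∷ I ++ J)            ≡⟨ countNbrs-↭ u (↭.prep x (↭-sym (shift y I J))) ⟩
    countNbrs G u (x ∷ I ++ y ∷ J)            ∎
    where open ≤-Reasoning

  data Attachment (u : V G) (L : List (V G)) : Set where
    detached : Anticomplete u L → Attachment u L
    single   : ∀ A y B → L ≡ A ++ y ∷ B → u ~ y →
               Anticomplete u A → Anticomplete u B → Attachment u L
    several  : ∀ A y₁ M y₂ B → L ≡ A ++ y₁ ∷ M ++ y₂ ∷ B → u ~ y₁ → u ~ y₂ →
               Anticomplete u A → Anticomplete u B → Attachment u L

  attachment : ∀ u L → Attachment u L
  attachment u L with Any.any? (u ~?_) L
  ... | no  none = detached (¬Any⇒All¬ L none)
  ... | yes some with first-split (u ~?_) some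
  ...   | first-at A y R refl ¬A u~y with Any.any? (u ~?_) R
  ...     | no  none′ = single A y R refl u~y ¬A (¬Any⇒All¬ R none′)
  ...     | yes some′ with last-split (u ~?_) some′
  ...       | last-at M y₂ B refl u~y₂ ¬B = several A y M y₂ B refl u~y u~y₂ ¬A ¬B

  single-unique : ∀ {u L A y B w} → L ≡ A ++ y ∷ B → Anticomplete u A → Anticomplete u B →
                  w ∈ L → u ~ w → w ≡ y
  single-unique {A = A} refl ¬A ¬B w∈ u~w with ∈-++⁻ A w∈
  ... | inj₁ w∈A          = ⊥-elim (All.lookup ¬A w∈A u~w)
  ... | inj₂ (here w≡y)   = w≡y
  ... | inj₂ (there w∈B)  = ⊥-elim (All.lookup ¬B w∈B u~w)

  countNbrs-single : ∀ u A y B → u ~ y → Anticomplete u A → Anticomplete u B →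
                     countNbrs G u (A ++ y ∷ B) ≡ 1
  countNbrs-single u A y B u~y ¬A ¬B = begin
    countNbrs G u (A ++ y ∷ B)              ≡⟨ countNbrs-++ u A (y ∷ B) ⟩
    countNbrs G u A + countNbrs G u (y ∷ B) ≡⟨ cong₂ _+_ (countNbrs-none u A ¬A) (countNbrs-∷-adj B u~y) ⟩
    suc (countNbrs G u B)                   ≡⟨ cong suc (countNbrs-none u B ¬B) ⟩
    1                                       ∎
    where open ≡-Reasoning

  countNbrs-several : ∀ u A y₁ M y₂ B → u ~ y₁ → u ~ y₂ →
                      2 ≤ countNbrs G u (A ++ y₁ ∷ M ++ y₂ ∷ B)
  countNbrs-several u A y₁ M y₂ B u~y₁ u~y₂ = begin
    2                                           ≤⟨ s≤s (countNbrs-any u (M ++ y₂ ∷ B) (Any-++⁺ʳ M (here u~y₂))) ⟩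
    suc (countNbrs G u (M ++ y₂ ∷ B))           ≡⟨ countNbrs-∷-adj (M ++ y₂ ∷ B) u~y₁ ⟨
    countNbrs G u (y₁ ∷ M ++ y₂ ∷ B)            ≤⟨ m≤n+m _ (countNbrs G u A) ⟩
    countNbrs G u A + countNbrs G u (y₁ ∷ M ++ y₂ ∷ B) ≡⟨ countNbrs-++ u A (y₁ ∷ M ++ y₂ ∷ B) ⟨
    countNbrs G u (A ++ y₁ ∷ M ++ y₂ ∷ B)       ∎
    where open ≤-Reasoning

  -- Reachability

  lastOr : V G → List (V G) → V G
  lastOr d []       = d
  lastOr d (x ∷ xs) = lastOr x xs

  lastOr-++ : ∀ d xs y ys → lastOr d (xs ++ y ∷ ys) ≡ lastOr y ys
  lastOr-++ d []       y ys = refl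
  lastOr-++ d (x ∷ xs) y ys = lastOr-++ x xs y ys

  induced-length : ∀ xs → Induced xs → length xs ≤ n
  induced-length xs p = injective⇒≤ lookup-injective
    where
    lookup-injective : ∀ {i j} → lookup xs i ≡ lookup xs j → i ≡ j
    lookup-injective {i} {j} e with toℕ i ℕ.≟ toℕ j
    ... | yes i≡j = toℕ-injective i≡j
    ... | no  i≢j = ⊥-elim (proj₁ (Induced⇒IsPath xs p) i j i≢j e)

  module _ (S : List (V G)) where

    record PathAvoiding (u v : V G) : Set where
      constructor path-avoiding
      field
        rest    : List (V G)
        induced : Induced (u ∷ rest)
        ends    : lastOr u rest ≡ v
        avoids  : All (_∉ S) (u ∷ rest)

    -- Cut the path at the last vertex that equals or is adjacent to u.
    path-shortcut : ∀ {u w v} → u ∉ S → u ~ w → PathAvoiding w v → PathAvoiding u v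
    path-shortcut {u} {w} {v} u∉S u~w (path-avoiding ws p e avoids)
      with last-split (touches? u) {w ∷ ws} (here (inj₂ u~w))
    ... | last-at A y B shape u-y ¬B =
      case u-y of λ
        { (inj₁ refl) → path-avoiding B suffix ends′ avoids′
        ; (inj₂ u~y)  → path-avoiding (y ∷ B)
                          ((u~y , ~-irrefl u~y , All.map ¬Touches⇒Far ¬B) , suffix)
                          ends′ (u∉S ∷ avoids′) }
      where
      suffix : Induced (y ∷ B)
      suffix = induced-++⁻ʳ A (y ∷ B) (subst Induced shape p)
      ends′ : lastOr y B ≡ v
      ends′ = trans (sym (lastOr-++ w A y B)) (trans (cong (lastOr w) (sym shape)) e)
      avoids′ : All (_∉ S) (y ∷ B)
      avoids′ = ++⁻ʳ A (subst (All (_∉ S)) shape avoids)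

    Reach⇒PathAvoiding : ∀ {u v} → Reach G S u v → PathAvoiding u v
    Reach⇒PathAvoiding (here u∉S)         = path-avoiding [] (tt , tt) refl (u∉S ∷ [])
    Reach⇒PathAvoiding (step u∉S u~w reach) = path-shortcut u∉S u~w (Reach⇒PathAvoiding reach)

    ReachWithin : ℕ → V G → V G → Set
    ReachWithin zero    u v = u ∉ S × u ≡ v
    ReachWithin (suc k) u v = u ∉ S × (u ≡ v ⊎ ∃[ w ] (u ~ w × ReachWithin k w v))

    reach-within? : ∀ k u v → Dec (ReachWithin k u v)
    reach-within? zero    u v = ¬? (u ∈? S) ×-dec u ≟ v
    reach-within? (suc k) u v =
      ¬? (u ∈? S) ×-dec (u ≟ v ⊎-dec any? (λ w → u ~? w ×-dec reach-within? k w v))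

    ReachWithin⇒Reach : ∀ k {u v} → ReachWithin k u v → Reach G S u v
    ReachWithin⇒Reach zero    (u∉S , refl)                     = here u∉S
    ReachWithin⇒Reach (suc k) (u∉S , inj₁ refl)                = here u∉S
    ReachWithin⇒Reach (suc k) (u∉S , inj₂ (w , u~w , reach))   = step u∉S u~w (ReachWithin⇒Reach k reach)

    ReachWithin-≤ : ∀ {j k u v} → j ≤ k → ReachWithin j u v → ReachWithin k u v
    ReachWithin-≤ {k = zero}  z≤n     reach                        = reach
    ReachWithin-≤ {k = suc k} z≤n     (u∉S , u≡v)                  = u∉S , inj₁ u≡v
    ReachWithin-≤             (s≤s j≤k) (u∉S , inj₁ u≡v)            = u∉S , inj₁ u≡v
    ReachWithin-≤             (s≤s j≤k) (u∉S , inj₂ (w , u~w , reach)) =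
      u∉S , inj₂ (w , u~w , ReachWithin-≤ j≤k reach)

    PathAvoiding⇒ReachWithin : ∀ {u v} (p : PathAvoiding u v) →
                               ReachWithin (length (PathAvoiding.rest p)) u v
    PathAvoiding⇒ReachWithin (path-avoiding []       _           e (u∉S ∷ _)) = u∉S , e
    PathAvoiding⇒ReachWithin (path-avoiding (y ∷ ys) ((u~y , _) , p) e (u∉S ∷ avoids)) =
      u∉S , inj₂ (y , u~y , PathAvoiding⇒ReachWithin (path-avoiding ys p e avoids))

    -- Atomicity only yields ¬ ¬ Reach, so reachability has to be decided.
    reach? : ∀ u v → Dec (Reach G S u v)
    reach? u v with reach-within? n u v
    ... | yes reach = yes (ReachWithin⇒Reach n reach)
    ... | no ¬reach = no λ reach →
      let p = Reach⇒PathAvoiding reach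
      in ¬reach (ReachWithin-≤ (≤-trans (n≤1+n _) (induced-length _ (PathAvoiding.induced p)))
                               (PathAvoiding⇒ReachWithin p))

  AllFar⇒Disjoint : ∀ {xs ys} → AllFar xs ys → Disjoint G xs ys
  AllFar⇒Disjoint far x x∈xs x∈ys = proj₁ (All.lookup (All.lookup far x∈xs) x∈ys) refl

  AllFar⇒NoEdges : ∀ {xs ys} → AllFar xs ys → NoEdges G xs ys
  AllFar⇒NoEdges far x y x∈xs y∈ys = proj₂ (All.lookup (All.lookup far x∈xs) y∈ys)

  ∷ʳ-nonempty : ∀ xs x → NonEmpty G (xs ++ [ x ])
  ∷ʳ-nonempty []       x = x , [] , refl
  ∷ʳ-nonempty (y ∷ xs) x = y , xs ++ [ x ] , refl

  theta : ∀ {u v} P₁ P₂ P₃ → ¬ u ~ v →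
          Induced (u ∷ P₁ ++ [ v ]) → Induced (u ∷ P₂ ++ [ v ]) → Induced (u ∷ P₃ ++ [ v ]) →
          NonEmpty G P₁ → NonEmpty G P₂ → NonEmpty G P₃ →
          AllFar P₁ P₂ → AllFar P₁ P₃ → AllFar P₂ P₃ → HasTheta G
  theta {u} {v} P₁ P₂ P₃ u≁v p₁ p₂ p₃ ne₁ ne₂ ne₃ far₁₂ far₁₃ far₂₃ =
    u , v , P₁ , P₂ , P₃ , u≁v ,
    Induced⇒IsPath _ p₁ , Induced⇒IsPath _ p₂ , Induced⇒IsPath _ p₃ , ne₁ , ne₂ , ne₃ ,
    AllFar⇒Disjoint far₁₂ , AllFar⇒Disjoint far₁₃ , AllFar⇒Disjoint far₂₃ ,
    AllFar⇒NoEdges far₁₂ , AllFar⇒NoEdges far₁₃ , AllFar⇒NoEdges far₂₃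

  -- The path acb

  module P3 (triangle-free : TriangleFree G) {a c b : V G}
            (a~c : a ~ c) (c~b : c ~ b) (a≁b : ¬ a ~ b) (a≢b : a ≢ b) where

    no-triangle : ∀ {x y z} → x ~ y → y ~ z → x ~ z → ⊥
    no-triangle x~y y~z x~z = triangle-free (_ , _ , _ , x~y , y~z , x~z)

    c≢a : c ≢ a
    c≢a = ~-irrefl (~-sym a~c)

    c≢b : c ≢ b
    c≢b = ~-irrefl c~b

    good⇒anticomplete : GoodP3 G a c b → ∀ I → Induced (a ∷ I ++ [ b ]) → c ∉ I → Anticomplete c I
    good⇒anticomplete good I p c∉I =
      All.tabulate (λ x∈I c~x → good I (Induced⇒IsPath _ p) c∉I _ x∈I (~-sym c~x))

    record HoleThrough (H : List (V G)) : Set where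
      constructor hole-through
      field
        middle : List (V G)
        hole   : Hole c a middle b
        perm   : c ∷ a ∷ middle ++ [ b ] ↭ H

    root-at-c : ∀ {H} → IsHole G H → a ∈ H → c ∈ H → b ∈ H → HoleThrough H
    root-at-c {H} h a∈H c∈H b∈H with hole-at m rh perm ← root-at h c∈H
      with Hole-root-nbrs rh (∈-resp-↭ (↭-sym perm) a∈H) (~-sym a~c)
         | Hole-root-nbrs rh (∈-resp-↭ (↭-sym perm) b∈H) c~b
    ... | inj₁ refl | inj₂ refl = hole-through m rh perm
    ... | inj₂ refl | inj₁ refl = hole-through (reverse m) (Hole-reflect rh) (↭-trans (reflect-↭ c b m a) perm)
    ... | inj₁ refl | inj₁ refl = ⊥-elim (a≢b refl)
    ... | inj₂ refl | inj₂ refl = ⊥-elim (a≢b refl)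

    -- Since {c} is not a clique separator, a reaches b in G ∖ c; a shortest such path
    -- closes with c into a hole because goodness keeps c away from its interior.
    good⇒hole : Atomic G → GoodP3 G a c b → ∃[ H ] (IsHole G H × a ∈ H × c ∈ H × b ∈ H)
    good⇒hole atomic good with reach? [ c ] a b
    ... | no ¬reach = ⊥-elim (atomic [ c ] (singleton-clique , a , b , a∉ , b∉ , ¬reach))
      where
      singleton-clique : IsClique G [ c ]
      singleton-clique _ _ (here refl) (here refl) c≢c = ⊥-elim (c≢c refl)
      a∉ : a ∉ [ c ]
      a∉ (here a≡c) = c≢a (sym a≡c)
      b∉ : b ∉ [ c ]
      b∉ (here b≡c) = c≢b (sym b≡c)
    ... | yes reach with Reach⇒PathAvoiding [ c ] reach
    ...   | path-avoiding ps p ends avoids with initLast ps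
    ...     | []       = ⊥-elim (a≢b ends)
    ...     | I ∷ʳ′ z with refl ← trans (sym (lastOr-++ a I z [])) ends =
      c ∷ a ∷ I ++ [ b ] , Hole⇒IsHole hole , there (here refl) , here refl ,
      there (there (∈-++⁺ʳ I (here refl)))
      where
      c∉I : c ∉ I
      c∉I c∈I = All.lookup (++⁻ˡ I (All.tail avoids)) c∈I (here refl)
      hole : Hole c a I b
      hole = record
        { rooted  = (~-sym a~c , c≢a ,
                     All.zip
                       (All.tabulate (λ {w} w∈I c≡w → c∉I (subst (_∈ I) (sym c≡w) w∈I)) ,
                        good⇒anticomplete good I p c∉I)) ,
                    induced-++⁻ˡ (a ∷ I) [ b ] p
        ; path    = p
        ; closing = c~b
        ; x≢z     = c≢b
        ; long    = λ { refl → a≁b (proj₁ (proj₁ p)) }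
        }

    -- a and b split the hole into two ab-paths avoiding c, so c sees at most a and b.
    good⇒no-wheel-at-c : GoodP3 G a c b → ¬ (∃[ H ] (IsWheel G H c × a ∈ H × b ∈ H))
    good⇒no-wheel-at-c good (H , (h , c∉H , three) , a∈H , b∈H)
      with hole-at {y} {z} m rh perm ← root-at h a∈H
      with ∈-resp-↭ (↭-sym perm) b∈H
    ... | here b≡a          = a≢b (sym b≡a)
    ... | there (here refl) = a≁b (Hole.x~y rh)
    ... | there (there b∈) with ∈-++⁻ m b∈
    ...   | inj₂ (here refl) = a≁b (Hole.closing rh)
    ...   | inj₁ b∈m with m₁ , m₂ , refl ← ∈-∃++ b∈m =
      <⇒≱ (s≤s (countNbrs-≤2 c a (y ∷ m₁) b (m₂ ++ [ z ]) ¬arc₁ ¬arc₂))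
        (subst (3 ≤_) (sym count) three)
      where
      in-H : ∀ {w} → w ∈ a ∷ y ∷ (m₁ ++ b ∷ m₂) ++ [ z ] → w ∈ H
      in-H = ∈-resp-↭ perm
      c∉arc₁ : c ∉ y ∷ m₁
      c∉arc₁ (here refl) = c∉H (in-H (there (here refl)))
      c∉arc₁ (there c∈m₁) = c∉H (in-H (there (there (∈-++⁺ˡ (∈-++⁺ˡ c∈m₁)))))
      c∉arc₂ : c ∉ z ∷ reverse m₂
      c∉arc₂ (here refl) = c∉H (in-H (there (there (∈-++⁺ʳ (m₁ ++ b ∷ m₂) (here refl)))))
      c∉arc₂ (there c∈m₂) =
        c∉H (in-H (there (there (∈-++⁺ˡ (∈-++⁺ʳ m₁ (there (∈-resp-↭ (↭-reverse m₂) c∈m₂)))))))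
      ¬arc₁ : Anticomplete c (y ∷ m₁)
      ¬arc₁ = good⇒anticomplete good (y ∷ m₁) (Hole-arc m₁ b m₂ rh refl) c∉arc₁
      ¬arc₂ : Anticomplete c (m₂ ++ [ z ])
      ¬arc₂ = All-resp-↭ (subst (_↭ m₂ ++ [ z ]) (reverse-∷ʳ m₂ z) (↭-reverse (m₂ ++ [ z ])))
                (good⇒anticomplete good (z ∷ reverse m₂)
                  (Hole-arc (reverse m₂) b (reverse m₁) (Hole-reflect rh) (reverse-middle m₁ b m₂))
                  c∉arc₂)
      count : countNbrs G c (a ∷ (y ∷ m₁) ++ b ∷ m₂ ++ [ z ]) ≡ countNbrs G c H
      count = trans (cong (λ l → countNbrs G c (a ∷ y ∷ l)) (sym (++-assoc m₁ (b ∷ m₂) [ z ])))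
                    (countNbrs-↭ c perm)

    nbr-of-c-≁a : ∀ {c′} → c ~ c′ → ¬ c′ ~ a
    nbr-of-c-≁a c~c′ c′~a = no-triangle a~c c~c′ (~-sym c′~a)

    nbr-of-c-≁b : ∀ {c′} → c ~ c′ → ¬ c′ ~ b
    nbr-of-c-≁b c~c′ c′~b = no-triangle c~b (~-sym c′~b) c~c′

    nbr-of-c-sees : ∀ {c′} q → c ~ c′ → countNbrs G c′ (c ∷ a ∷ q ++ [ b ]) ≡ suc (countNbrs G c′ q)
    nbr-of-c-sees {c′} q c~c′ = begin
      countNbrs G c′ (c ∷ a ∷ q ++ [ b ])   ≡⟨ countNbrs-∷-adj (a ∷ q ++ [ b ]) (~-sym c~c′) ⟩
      suc (countNbrs G c′ (a ∷ q ++ [ b ])) ≡⟨ cong suc (countNbrs-∷-nonadj (q ++ [ b ]) (nbr-of-c-≁a c~c′)) ⟩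
      suc (countNbrs G c′ (q ++ [ b ]))     ≡⟨ cong suc (countNbrs-++ c′ q [ b ]) ⟩
      suc (countNbrs G c′ q + countNbrs G c′ [ b ])
        ≡⟨ cong (λ k → suc (countNbrs G c′ q + k)) (countNbrs-none c′ [ b ] (nbr-of-c-≁b c~c′ ∷ [])) ⟩
      suc (countNbrs G c′ q + 0)            ≡⟨ cong suc (+-identityʳ _) ⟩
      suc (countNbrs G c′ q)                ∎
      where open ≡-Reasoning

    -- The first and last neighbours of c′ on the hole give an ab-path through c′ avoiding c.
    good⇒no-wheel-at-nbr : GoodP3 G a c b →
      ¬ (∃[ H ] ∃[ c′ ] (IsWheel G H c′ × a ∈ H × c ∈ H × b ∈ H × c ~ c′))
    good⇒no-wheel-at-nbr good (H , c′ , (h , c′∉H , three) , a∈H , c∈H , b∈H , c~c′)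
      with hole-through q hole perm ← root-at-c h a∈H c∈H b∈H
      with three′ ← subst (3 ≤_) (trans (sym (countNbrs-↭ c′ perm)) (nbr-of-c-sees q c~c′)) three
      with attachment c′ q
    ... | detached ¬q with s≤s () ← subst (λ k → 3 ≤ suc k) (countNbrs-none c′ q ¬q) three′
    ... | single A y B refl c′~y ¬A ¬B
      with s≤s (s≤s ()) ← subst (λ k → 3 ≤ suc k) (countNbrs-single c′ A y B c′~y ¬A ¬B) three′
    ... | several A y₁ M y₂ B refl c′~y₁ c′~y₂ ¬A ¬B =
      good I (Induced⇒IsPath _ detour) c∉I c′ (∈-++⁺ʳ A (there (here refl))) (~-sym c~c′)
      where
      I = A ++ y₁ ∷ c′ ∷ y₂ ∷ B
      shape : a ∷ (A ++ y₁ ∷ M ++ y₂ ∷ B) ++ [ b ] ≡ (a ∷ A) ++ y₁ ∷ M ++ y₂ ∷ B ++ [ b ]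
      shape = cong (a ∷_) (trans (++-assoc A (y₁ ∷ M ++ y₂ ∷ B) [ b ])
                (cong (λ l → A ++ y₁ ∷ l) (++-assoc M (y₂ ∷ B) [ b ])))
      detour : Induced (a ∷ I ++ [ b ])
      detour = subst Induced (cong (a ∷_) (sym (++-assoc A (y₁ ∷ c′ ∷ y₂ ∷ B) [ b ])))
        (induced-detour (a ∷ A) y₁ M y₂ (B ++ [ b ]) (subst Induced shape (Hole.path hole))
          c′~y₁ c′~y₂ (λ y₁~y₂ → no-triangle (~-sym c′~y₁) c′~y₂ y₁~y₂)
          (λ c′∈ → c′∉H (∈-resp-↭ perm (there (subst (c′ ∈_) (sym shape) c′∈))))
          (nbr-of-c-≁a c~c′ ∷ ¬A) (++⁺ ¬B (nbr-of-c-≁b c~c′ ∷ [])))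
      c∉I : c ∉ I
      c∉I = ∉-detour A y₁ M y₂ B (Far⇒∉ (Hole.x-far-m hole)) (~-irrefl c~c′)

    -- The path and the arc b q a close into a hole on which c sees a, b and its
    -- neighbour on the path.
    far-path⇒wheel : ∀ {q} → Hole c a q b → ∀ I → Induced (a ∷ I ++ [ b ]) → c ∉ I →
                     Any (c ~_) I → AllFar I q → ∃[ H ] (IsWheel G H c × a ∈ H × b ∈ H)
    far-path⇒wheel {q} hole I p c∉I c~I far =
      a ∷ I ++ b ∷ reverse q ,
      (paths⇒IsHole I q p (Hole.path hole) far (λ { refl → case c~I of λ () }) (Hole.long hole) ,
       c∉H , countNbrs-≥3 c a I b (reverse q) (~-sym a~c) c~b c~I) ,
      here refl , there (∈-++⁺ʳ I (here refl))
      where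
      c∉H : c ∉ a ∷ I ++ b ∷ reverse q
      c∉H (here c≡a) = c≢a c≡a
      c∉H (there c∈) with ∈-++⁻ I c∈
      ... | inj₁ c∈I         = c∉I c∈I
      ... | inj₂ (here c≡b)  = c≢b c≡b
      ... | inj₂ (there c∈q) = Far⇒∉ (Hole.x-far-m hole) (∈-resp-↭ (↭-reverse q) c∈q)

    NoWheelAtNbr : Set
    NoWheelAtNbr = ∀ {H c′} → IsWheel G H c′ → a ∈ H → c ∈ H → b ∈ H → c ~ c′ → ⊥

    module AroundHole (θ-free : ThetaFree G) (no-wheel : NoWheelAtNbr) {q} (hole : Hole c a q b) where

      Q : List (V G)
      Q = a ∷ q ++ [ b ]

      Q-induced : Induced Q
      Q-induced = Hole.path hole

      c-far-q : All (Far c) q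
      c-far-q = Hole.x-far-m hole

      c-nbrs : ∀ {w} → w ∈ Q → c ~ w → w ≡ a ⊎ w ≡ b
      c-nbrs w∈ = Hole-root-nbrs hole (there w∈)

      c∉Q : c ∉ Q
      c∉Q (here c≡a) = c≢a c≡a
      c∉Q (there c∈) with ∈-++⁻ q c∈
      ... | inj₁ c∈q        = Far⇒∉ c-far-q c∈q
      ... | inj₂ (here c≡b) = c≢b c≡b

      split-inner : ∀ {A y R} → Q ≡ A ++ y ∷ R → y ≢ a → y ≢ b →
                    ∃[ A′ ] ∃[ B′ ] (A ≡ a ∷ A′ × R ≡ B′ ++ [ b ] × q ≡ A′ ++ y ∷ B′)
      split-inner {[]}     refl y≢a _ = ⊥-elim (y≢a refl)
      split-inner {_ ∷ A′} {y} {R} e y≢a y≢b with refl , e′ ← ∷-injective e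
        with B′ , R≡ , q≡ ← ∷ʳ-split q A′ R e′ y≢b = A′ , B′ , refl , R≡ , q≡

      -- T and the two arcs of the hole from c to y form a theta.
      theta-via-inner : ∀ {A y R} T → Q ≡ A ++ y ∷ R → y ≢ a → y ≢ b → NonEmpty G T →
                        Induced (c ∷ T ++ [ y ]) → AllFar T (A ++ R) → ⊥
      theta-via-inner {A} {y} {R} T e y≢a y≢b ne p far
        with A′ , B′ , refl , refl , refl ← split-inner e y≢a y≢b =
        θ-free (theta T (a ∷ A′) (b ∷ reverse B′) c≁y p
                  (Hole-arc A′ y B′ hole refl)
                  (Hole-arc (reverse B′) y (reverse A′) (Hole-reflect hole) (reverse-middle A′ y B′))
                  ne (a , A′ , refl) (b , reverse B′ , refl)
                  (AllFar-⊆ʳ (∈-++⁺ˡ {ys = B′ ++ [ b ]}) far)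
                  (AllFar-⊆ʳ (∈-++⁺ʳ (a ∷ A′) ∘ from-reversed) far)
                  (AllFar-⊆ʳ from-reversed
                    (induced-far (a ∷ A′) y (B′ ++ [ b ])
                      (subst Induced (cong (a ∷_) (++-assoc A′ (y ∷ B′) [ b ])) Q-induced))))
        where
        c≁y : ¬ c ~ y
        c≁y = proj₂ (All.head (++⁻ʳ A′ c-far-q))
        from-reversed : ∀ {w} → w ∈ b ∷ reverse B′ → w ∈ B′ ++ [ b ]
        from-reversed = ∈-resp-↭ (∷-reverse-↭ B′ b)

      -- T, the arc from c through a to y₁ then t, and the arc from c through b to y₂ then
      -- t form a theta; y₁ ≁ y₂ since both are adjacent to t.
      theta-via-outer : ∀ {A y₁ M y₂ B t} T → Q ≡ A ++ y₁ ∷ M ++ y₂ ∷ B →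
                        t ~ y₁ → t ~ y₂ → Anticomplete t A → Anticomplete t B → t ∉ Q →
                        NonEmpty G T → Induced (c ∷ T ++ [ t ]) → AllFar T Q → ⊥
      theta-via-outer {A} {y₁} {M} {y₂} {B} {t} T e t~y₁ t~y₂ ¬A ¬B t∉Q ne@(s , T′ , refl) p far =
        θ-free (theta T (A ++ [ y₁ ]) (reverse B ++ [ y₂ ]) (proj₂ c-far-t) p arc₁ arc₂
                  ne (∷ʳ-nonempty A y₁) (∷ʳ-nonempty (reverse B) y₂)
                  (AllFar-⊆ʳ (in-Q ∘ y₁-side) far) (AllFar-⊆ʳ (in-Q ∘ y₂-side) far)
                  (AllFar-⊆ʳ (∈-resp-↭ (reverse-∷ʳ-↭ B y₂))
                    (induced-far-apart A y₁ M y₂ B (subst Induced e Q-induced)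
                      (λ y₁~y₂ → no-triangle (~-sym t~y₁) t~y₂ y₁~y₂))))
        where
        c-far-t : Far c t
        c-far-t = All.head (++⁻ʳ T′ (proj₂ (proj₂ (proj₁ p))))
        in-Q : ∀ {w} → w ∈ A ++ y₁ ∷ M ++ y₂ ∷ B → w ∈ Q
        in-Q w∈ = subst (_ ∈_) (sym e) w∈
        t-far : ∀ {w} → w ∈ A ++ y₁ ∷ M ++ y₂ ∷ B → ¬ t ~ w → Far t w
        t-far w∈ t≁w = (λ { refl → t∉Q (in-Q w∈) }) , t≁w
        y₁-side : ∀ {w} → w ∈ A ++ [ y₁ ] → w ∈ A ++ y₁ ∷ M ++ y₂ ∷ B
        y₁-side w∈ with ∈-++⁻ A w∈
        ... | inj₁ w∈A         = ∈-++⁺ˡ w∈A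
        ... | inj₂ (here refl) = ∈-++⁺ʳ A (here refl)
        y₂-side : ∀ {w} → w ∈ reverse B ++ [ y₂ ] → w ∈ A ++ y₁ ∷ M ++ y₂ ∷ B
        y₂-side w∈ with ∈-resp-↭ (reverse-∷ʳ-↭ B y₂) w∈
        ... | here refl = ∈-++⁺ʳ A (there (∈-++⁺ʳ M (here refl)))
        ... | there w∈B = ∈-++⁺ʳ A (there (∈-++⁺ʳ M (there w∈B)))
        arc₁ : Induced (c ∷ (A ++ [ y₁ ]) ++ [ t ])
        arc₁ = Hole-exit A y₁ (M ++ y₂ ∷ B) hole e (++-∷-≢[] M y₂ B) (~-sym t~y₁)
          (λ { refl → t∉Q (in-Q (∈-++⁺ʳ A (here refl))) })
          (Far-sym c-far-t ∷ All.tabulate (λ w∈A → t-far (∈-++⁺ˡ w∈A) (All.lookup ¬A w∈A)))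
        arc₂ : Induced (c ∷ (reverse B ++ [ y₂ ]) ++ [ t ])
        arc₂ = Hole-exit (reverse B) y₂ (reverse (A ++ y₁ ∷ M)) (Hole-reflect hole) reversed
          (reverse-≢[] (A ++ y₁ ∷ M) (++-∷-≢[] A y₁ M)) (~-sym t~y₂)
          (λ { refl → t∉Q (in-Q (y₂-side (∈-++⁺ʳ (reverse B) (here refl)))) })
          (Far-sym c-far-t ∷ All.tabulate (λ w∈B →
             t-far (y₂-side (∈-++⁺ˡ w∈B)) (All.lookup ¬B (∈-resp-↭ (↭-reverse B) w∈B))))
          where
          reversed : b ∷ reverse q ++ [ a ] ≡ reverse B ++ y₂ ∷ reverse (A ++ y₁ ∷ M)
          reversed = begin
            b ∷ reverse q ++ [ a ]                  ≡⟨ reverse-ends a q b ⟨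
            reverse Q                              ≡⟨ cong reverse e ⟩
            reverse (A ++ y₁ ∷ M ++ y₂ ∷ B)         ≡⟨ cong reverse (++-assoc A (y₁ ∷ M) (y₂ ∷ B)) ⟨
            reverse ((A ++ y₁ ∷ M) ++ y₂ ∷ B)       ≡⟨ reverse-middle (A ++ y₁ ∷ M) y₂ B ⟩
            reverse B ++ y₂ ∷ reverse (A ++ y₁ ∷ M) ∎
            where open ≡-Reasoning

      pivot-∈ : ∀ {A y R} → Q ≡ A ++ y ∷ R → y ∈ Q
      pivot-∈ {A} e = subst (_ ∈_) (sym e) (∈-++⁺ʳ A (here refl))

      off-pivot-far : ∀ {A y R t} → Q ≡ A ++ y ∷ R → t ∉ Q →
                      Anticomplete t A → Anticomplete t R → All (Far t) (A ++ R)
      off-pivot-far {A} {y} {R} e t∉Q ¬A ¬R = All.tabulate λ w∈ →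
        (λ { refl → t∉Q (subst (_ ∈_) (sym e) (in-split w∈)) }) ,
        All.lookup (++⁺ ¬A ¬R) w∈
        where
        in-split : ∀ {w} → w ∈ A ++ R → w ∈ A ++ y ∷ R
        in-split w∈ with ∈-++⁻ A w∈
        ... | inj₁ w∈A = ∈-++⁺ˡ w∈A
        ... | inj₂ w∈R = ∈-++⁺ʳ A (there w∈R)

      c-far-inner : ∀ {y} → y ∈ Q → y ≢ a → y ≢ b → Far c y
      c-far-inner y∈ y≢a y≢b =
        (λ { refl → c∉Q y∈ }) , λ c~y → Sum.[ y≢a , y≢b ] (c-nbrs y∈ c~y)

      -- A neighbour t of c off the hole sees nothing of it: two neighbours would make
      -- (c ∷ Q, t) a wheel, and a single one y gives the theta c t y.
      c-nbr-detached : ∀ {t} → t ∉ Q → t ~ c → Anticomplete t Q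
      c-nbr-detached t∉Q t~c with attachment _ Q
      ... | detached ¬Q = ¬Q
      ... | several A y₁ M y₂ B e t~y₁ t~y₂ _ _ =
        ⊥-elim (no-wheel (Hole⇒IsHole hole , t∉ , three) (there (here refl)) (here refl)
                  (there (there (∈-++⁺ʳ q (here refl)))) (~-sym t~c))
        where
        t∉ : _ ∉ c ∷ Q
        t∉ (here refl) = ~-irrefl t~c refl
        t∉ (there t∈)  = t∉Q t∈
        three : 3 ≤ countNbrs G _ (c ∷ Q)
        three = subst (3 ≤_) (sym (countNbrs-∷-adj Q t~c))
                  (s≤s (subst (λ l → 2 ≤ countNbrs G _ l) (sym e) (countNbrs-several _ A y₁ M y₂ B t~y₁ t~y₂)))
      ... | single A y R e t~y ¬A ¬R =
        ⊥-elim (theta-via-inner [ _ ] e y≢a y≢b (_ , [] , refl)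
                  ((~-sym t~c , ~-irrefl (~-sym t~c) , c-far-inner (pivot-∈ e) y≢a y≢b ∷ []) ,
                   (t~y , (λ { refl → t∉Q (pivot-∈ e) }) , []) , tt , tt)
                  (off-pivot-far e t∉Q ¬A ¬R ∷ []))
        where
        y≢a : _ ≢ a
        y≢a refl = no-triangle t~y a~c t~c
        y≢b : _ ≢ b
        y≢b refl = no-triangle t~c c~b t~y

      -- Any other attachment of t completes one of the two thetas above.
      end-attachment : ∀ {t} T → NonEmpty G T → Induced (c ∷ T ++ [ t ]) → AllFar T Q →
                       t ∉ Q → Any (t ~_) Q → (t ~ a × Anticomplete t q) ⊎ t ~ b
      end-attachment {t} T ne p far t∉Q some with attachment t Q
      ... | detached ¬Q = ⊥-elim (All¬⇒¬Any ¬Q some)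
      ... | several A y₁ M y₂ B e t~y₁ t~y₂ ¬A ¬B =
        ⊥-elim (theta-via-outer T e t~y₁ t~y₂ ¬A ¬B t∉Q ne p far)
      ... | single A y R e t~y ¬A ¬R with y ≟ a | y ≟ b
      ...   | yes refl | _        = inj₁ (t~y , All.tabulate only-a)
        where
        only-a : ∀ {w} → w ∈ q → ¬ t ~ w
        only-a w∈q t~w with refl ← single-unique e ¬A ¬R (there (∈-++⁺ˡ w∈q)) t~w =
          All.lookup (++⁻ˡ q (induced-distinctʳ [] a (q ++ [ b ]) Q-induced)) w∈q refl
      ...   | no _     | yes refl = inj₂ t~y
      ...   | no y≢a   | no y≢b   =
        ⊥-elim (theta-via-inner (T ++ [ t ]) e y≢a y≢b (∷ʳ-nonempty T t)
                  (subst (Induced ∘ (c ∷_)) (sym (++-assoc T [ t ] [ y ]))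
                    (induced-∷ʳ (c ∷ T) t y p t~y (λ { refl → t∉Q y∈ })
                      (Far-sym (c-far-inner y∈ y≢a y≢b) ∷
                       All.map (λ v-far → Far-sym (All.lookup v-far y∈)) far)))
                  (++⁺ (AllFar-⊆ʳ (λ w∈ → subst (_ ∈_) (sym e) (off-pivot w∈)) far)
                       (off-pivot-far e t∉Q ¬A ¬R ∷ [])))
        where
        y∈ = pivot-∈ e
        off-pivot : ∀ {w} → w ∈ A ++ R → w ∈ A ++ y ∷ R
        off-pivot w∈ with ∈-++⁻ A w∈
        ... | inj₁ w∈A = ∈-++⁺ˡ w∈A
        ... | inj₂ w∈R = ∈-++⁺ʳ A (there w∈R)

      Touches-Q : V G → Set
      Touches-Q u = Any (Touches u) Q


      -- The
      -- first vertex t touching the hole is reached by an outside path from c, leaving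
      -- from the last neighbour of c before t, so end-attachment applies to it.
      first-contact : ∀ x S → Induced (x ∷ S) → x ~ c → x ∉ Q → c ∉ S → Any Touches-Q S →
                      ∃[ t ] (t ∈ S × t ∉ Q × ((t ~ a × Anticomplete t q) ⊎ t ~ b))
      first-contact x S p x~c x∉Q c∉S some
        with first-split (λ u → Any.any? (touches? u) Q) {x ∷ S} (there some)
      ... | first-at []        t S′ refl _ x-touches =
        ⊥-elim (All¬⇒¬Any (c-nbr-detached x∉Q x~c) (touches⇒adjacent x∉Q x-touches))
      ... | first-at (_ ∷ F′) t S′ refl untouched t-touches =
        t , ∈-++⁺ʳ F′ (here refl) , t∉Q ,
        attach (c-path-from-last-nbr (x ∷ F′) t prefix c∉ c≁t (here x~c))
        where
        prefix : Induced (x ∷ F′ ++ [ t ])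
        prefix = induced-++⁻ˡ (x ∷ F′ ++ [ t ]) S′
                   (subst (Induced ∘ (x ∷_)) (sym (++-assoc F′ [ t ] S′)) p)
        t∉Q : t ∉ Q
        t∉Q t∈Q with w , w∈F , w~t ← find (induced-∷ʳ-adjacent x F′ t prefix) =
          All.lookup untouched w∈F (Any.map (λ { refl → inj₂ w~t }) t∈Q)
        t~Q : Any (t ~_) Q
        t~Q = touches⇒adjacent t∉Q t-touches
        c≁t : ¬ c ~ t
        c≁t c~t = All¬⇒¬Any (c-nbr-detached t∉Q (~-sym c~t)) t~Q
        c∉ : c ∉ x ∷ F′ ++ [ t ]
        c∉ (here refl) = ~-irrefl x~c refl
        c∉ (there c∈)  = c∉S (subst (c ∈_) (++-assoc F′ [ t ] S′) (∈-++⁺ˡ c∈))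
        attach : ∃[ s ] ∃[ F₂ ] (Induced (c ∷ s ∷ F₂ ++ [ t ]) × (∀ {w} → w ∈ s ∷ F₂ → w ∈ x ∷ F′)) →
                 (t ~ a × Anticomplete t q) ⊎ t ~ b
        attach (s , F₂ , c-path , in-F) =
          end-attachment (s ∷ F₂) (s , F₂ , refl) c-path
            (All.tabulate (untouched⇒far Q ∘ All.lookup untouched ∘ in-F)) t∉Q t~Q

      path-c-nbr∉Q : ∀ pre x R → Induced (a ∷ pre ++ x ∷ R) → b ∈ R → x ~ c → x ∉ Q
      path-c-nbr∉Q pre x R p b∈R x~c x∈Q with c-nbrs x∈Q (~-sym x~c)
      ... | inj₁ refl = All.lookup (induced-distinctʳ [] a (pre ++ x ∷ R) p) (∈-++⁺ʳ pre (here refl)) refl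
      ... | inj₂ refl = All.lookup (induced-distinctʳ (a ∷ pre) x R p) b∈R refl

      path-c-nbr-far : ∀ pre x R → Induced (a ∷ pre ++ x ∷ R) → b ∈ R → x ~ c → All (Far x) q
      path-c-nbr-far pre x R p b∈R x~c =
        All.tabulate λ w∈q → (λ { refl → x∉Q (there (∈-++⁺ˡ w∈q)) }) ,
                             All.lookup (c-nbr-detached x∉Q x~c) (there (∈-++⁺ˡ w∈q))
        where
        x∉Q = path-c-nbr∉Q pre x R p b∈R x~c

      -- Along an ab-path through a neighbour x of c, every vertex v before x is far from
      -- q: otherwise first-contact, run backwards from x towards v, finds a vertex t
      -- between v and x attached to the hole only at a or at b, which the path forbids.
      before-x-far : ∀ pre x R → Induced (a ∷ pre ++ x ∷ R) → b ∈ R → c ∉ pre → x ~ c →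
                     ∀ {v} → v ∈ pre → All (Far v) q
      before-x-far pre x R p b∈R c∉pre x~c {v} v∈pre
        with pL , pR , refl ← ∈-∃++ v∈pre = untouched⇒far q λ v-touches →
        contact v-touches
          (first-contact x (reverse pR ++ [ v ]) S-induced x~c x∉Q
            (c∉segment ∘ ∈-resp-↭ (reverse-∷ʳ-↭ pR v))
            (Any-++⁺ʳ (reverse pR) (here (there (Any-++⁺ˡ v-touches)))))
        where
        p₀ : Induced (a ∷ pL ++ v ∷ pR ++ x ∷ R)
        p₀ = subst Induced (cong (a ∷_) (++-assoc pL (v ∷ pR) (x ∷ R))) p
        segment : Induced (v ∷ pR ++ [ x ])
        segment = induced-infix (a ∷ pL) (v ∷ pR ++ [ x ]) R
          (subst Induced (cong (λ l → a ∷ pL ++ v ∷ l) (sym (++-assoc pR [ x ] R))) p₀)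
        S-induced : Induced (x ∷ reverse pR ++ [ v ])
        S-induced = subst Induced (reverse-ends v pR x) (induced-reverse _ segment)
        c∉segment : c ∉ v ∷ pR
        c∉segment c∈ = c∉pre (∈-++⁺ʳ pL c∈)
        x∉Q : x ∉ Q
        x∉Q = path-c-nbr∉Q (pL ++ v ∷ pR) x R p b∈R x~c
        contact : Any (Touches v) q →
                  ∃[ t ] (t ∈ reverse pR ++ [ v ] × t ∉ Q × ((t ~ a × Anticomplete t q) ⊎ t ~ b)) → ⊥
        contact v-touches (t , t∈ , t∉Q , attached) with ∈-resp-↭ (reverse-∷ʳ-↭ pR v) t∈ | attached
        ... | t∈vpR      | inj₂ t~b =
          proj₂ (All.lookup (All.lookup (induced-far (a ∷ pL ++ v ∷ pR) x R p)
                   (there (∈-++⁺ʳ pL t∈vpR))) b∈R) t~b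
        ... | here refl  | inj₁ (t~a , ¬q) =
          All¬⇒¬Any (All.tabulate λ w∈q → λ { (inj₁ refl) → t∉Q (there (∈-++⁺ˡ w∈q))
                                             ; (inj₂ t~w)  → All.lookup ¬q w∈q t~w }) v-touches
        ... | there t∈pR | inj₁ (t~a , _) =
          proj₂ (All.lookup (All.lookup (induced-far (a ∷ pL) v (pR ++ x ∷ R) p₀) (here refl))
                  (∈-++⁺ˡ t∈pR)) (~-sym t~a)

  module Backward (triangle-free : TriangleFree G) (θ-free : ThetaFree G) {a c b : V G}
                  (a~c : a ~ c) (c~b : c ~ b) (a≁b : ¬ a ~ b) (a≢b : a ≢ b)
                  (no-wheel-nbr : ¬ (∃[ H ] ∃[ c′ ] (IsWheel G H c′ × a ∈ H × c ∈ H × b ∈ H × c ~ c′)))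
                  where

    module P  = P3 triangle-free a~c c~b a≁b a≢b
    module P′ = P3 triangle-free (~-sym c~b) (~-sym a~c) (a≁b ∘ ~-sym) (a≢b ∘ sym)

    -- The vertices after x are handled by the same argument on the reversed path and
    -- the reflected hole, i.e. with the roles of a and b exchanged.
    interior-far : ∀ {q} → Hole c a q b → ∀ pre x post → Induced (a ∷ (pre ++ x ∷ post) ++ [ b ]) →
                   c ∉ pre ++ x ∷ post → x ~ c → AllFar (pre ++ x ∷ post) q
    interior-far {q} hole pre x post p c∉I x~c =
      ++⁺ (All.tabulate (A.before-x-far pre x (post ++ [ b ]) p₁ b∈ (c∉I ∘ ∈-++⁺ˡ) x~c))
          (A.path-c-nbr-far pre x (post ++ [ b ]) p₁ b∈ x~c ∷
           All.tabulate (λ v∈post → All-resp-↭ (↭-reverse q)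
             (A′.before-x-far (reverse post) x (reverse pre ++ [ a ]) p-rev a∈ c∉post x~c
                (∈-resp-↭ (↭-sym (↭-reverse post)) v∈post))))
      where
      module A  = P.AroundHole θ-free (λ w a∈ c∈ b∈ c~c′ → no-wheel-nbr (_ , _ , w , a∈ , c∈ , b∈ , c~c′))
                    hole
      module A′ = P′.AroundHole θ-free (λ w b∈ c∈ a∈ c~c′ → no-wheel-nbr (_ , _ , w , a∈ , c∈ , b∈ , c~c′))
                    (Hole-reflect hole)
      p₁ : Induced (a ∷ pre ++ x ∷ post ++ [ b ])
      p₁ = subst Induced (cong (a ∷_) (++-assoc pre (x ∷ post) [ b ])) p
      p-rev : Induced (b ∷ reverse post ++ x ∷ reverse pre ++ [ a ])
      p-rev = subst Induced reversed (induced-reverse _ p)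
        where
        open ≡-Reasoning
        reversed : reverse (a ∷ (pre ++ x ∷ post) ++ [ b ]) ≡ b ∷ reverse post ++ x ∷ reverse pre ++ [ a ]
        reversed = begin
          reverse (a ∷ (pre ++ x ∷ post) ++ [ b ])       ≡⟨ reverse-ends a (pre ++ x ∷ post) b ⟩
          b ∷ reverse (pre ++ x ∷ post) ++ [ a ]         ≡⟨ cong (λ l → b ∷ l ++ [ a ]) (reverse-middle pre x post) ⟩
          b ∷ (reverse post ++ x ∷ reverse pre) ++ [ a ] ≡⟨ cong (b ∷_) (++-assoc (reverse post) (x ∷ reverse pre) [ a ]) ⟩
          b ∷ reverse post ++ x ∷ reverse pre ++ [ a ]   ∎
      b∈ : b ∈ post ++ [ b ]
      b∈ = ∈-++⁺ʳ post (here refl)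
      a∈ : a ∈ reverse pre ++ [ a ]
      a∈ = ∈-++⁺ʳ (reverse pre) (here refl)
      c∉post : c ∉ reverse post
      c∉post = c∉I ∘ ∈-++⁺ʳ pre ∘ there ∘ ∈-resp-↭ (↭-reverse post)

    conditions⇒good : ∃[ H ] (IsHole G H × a ∈ H × c ∈ H × b ∈ H) →
                      ¬ (∃[ H ] (IsWheel G H c × a ∈ H × b ∈ H)) → GoodP3 G a c b
    conditions⇒good (H , h , a∈H , c∈H , b∈H) no-wheel-c I path c∉I x x∈I x~c
      with P.hole-through q hole _ ← P.root-at-c h a∈H c∈H b∈H
      with pre , post , refl ← ∈-∃++ x∈I =
      no-wheel-c (P.far-path⇒wheel hole (pre ++ x ∷ post) p c∉I (Any.map (λ { refl → ~-sym x~c }) x∈I)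
                    (interior-far hole pre x post p c∉I x~c))
      where
      p : Induced (a ∷ (pre ++ x ∷ post) ++ [ b ])
      p = IsPath⇒Induced _ path

lemmal : ∀ {n : ℕ} (G : Graph n) → Atomic G → ThetaFree G → TriangleFree G →
    ∀ a c b → IsPath G (a ∷ c ∷ b ∷ []) →
    GoodP3 G a c b ⇔
      ((∃[ H ] (IsHole G H × a ∈ H × c ∈ H × b ∈ H)) ×
       (¬ (∃[ H ] (IsWheel G H c × a ∈ H × b ∈ H))) ×
       (¬ (∃[ H ] ∃[ c′ ] (IsWheel G H c′ × a ∈ H × c ∈ H × b ∈ H × Adj G c c′))))
lemmal G atomic θ-free triangle-free a c b path
  with (a~c , _ , (a≢b , a≁b) ∷ []) , (c~b , _) , _ ← Graphs.IsPath⇒Induced G _ path =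
  mk⇔ (λ good → good⇒hole atomic good , good⇒no-wheel-at-c good , good⇒no-wheel-at-nbr good)
      (λ (hole , no-wheel-c , no-wheel-nbr) →
         Backward.conditions⇒good triangle-free θ-free a~c c~b a≁b a≢b no-wheel-nbr hole no-wheel-c)
  where
  open Graphs G
  open P3 triangle-free a~c c~b a≁b a≢b
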